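{- Let $n=p_1^{e_1}p_2^{e_2}\cdots p_s^{e_s}$ be an odd composite integer (distinct primes $p_i$, exponents $e_i\ge 1$), and let $n'=p_1p_2\cdots p_s$. Then $n$ is a weak Carmichael number if and only if $\lambda(n')\mid n-1$.
   Context: $\lambda(m)$ denotes the Carmichael function: the smallest positive integer $t$ such that $a^t\equiv 1\pmod m$ for all integers $a$ coprime to $m$. A composite positive integer $n$ is called a weak Carmichael number if $\sum_{1\le k\le n-1,\ \gcd(k,n)=1} k^{n-1}\equiv \varphi(n)\pmod{n}$, where $\varphi$ is Euler's totient function. -}

module Defs where

open import Data.Nat using (ℕ; zero; suc; _+_; _*_; _∸_; _^_; _≤_; _<_)
open import Data.Nat.Coprimality using (Coprime; coprime?)
open import Data.Nat.Divisibility using (_∣_; _∣?_)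
open import Data.Nat.Primality using (Prime; prime?)
open import Data.List using (List; filter; map; upTo; length)
open import Data.Nat.ListAction using (sum; product)
open import Data.Product using (_×_)
open import Relation.Nullary.Decidable using (_×-dec_)
open import Data.Integer as ℤ using (ℤ; +_)
import Data.Integer.Divisibility as ℤD

_≡_[mod_] : ℕ → ℕ → ℕ → Set
a ≡ b [mod m ] = (+ m) ℤD.∣ ((+ a) ℤ.- (+ b))

coprimesBelow : ℕ → List ℕ
coprimesBelow n = filter (λ k → coprime? k n) (upTo n)

-- Euler's totient φ(n) = #{ 1 ≤ k ≤ n : gcd(k,n)=1 }
-- (for n ≥ 2 this equals #{ 0 ≤ k < n : gcd(k,n)=1 }, since gcd(0,n)=n≠1 and gcd(n,n)=n≠1)
φ : ℕ → ℕ
φ n = length (filter (λ k → coprime? k n) (map suc (upTo n)))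

weakSum : ℕ → ℕ
weakSum n = sum (map (λ k → k ^ (n ∸ 1))
                     (filter (λ k → coprime? k n) (map suc (upTo (n ∸ 1)))))

WeakCarmichael : ℕ → Set
WeakCarmichael n = Data.Nat.Primality.Composite n × (weakSum n ≡ φ n [mod n ])

radical : ℕ → ℕ
radical n = product (filter (λ p → prime? p ×-dec (p ∣? n)) (upTo (suc n)))

Exponent : ℕ → ℕ → Set
Exponent m t = ∀ a → Coprime a m → (a ^ t) ≡ 1 [mod m ]

IsCarmichaelλ : ℕ → ℕ → Set
IsCarmichaelλ m t = (0 < t) × Exponent m t × (∀ s → 0 < s → Exponent m s → t ≤ s)

-- Write n = r d with r = rad n and let m = n - 1, which is prime to r. Every prime of n divides r,
-- so (1 + r t)^(r^m) ≡ 1 (mod n); as m is invertible modulo r^m, x ↦ x^m permutes the residues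
-- 1 + r j (j < d) modulo n, whose sum is d for odd d. Summing over the cosets c + rℤ then gives
-- ∑_{(k,n)=1} k^m ≡ d T (mod n) with T = ∑_{c<r, (c,r)=1} c^m, while φ(n) = d φ(r); so n is weak
-- Carmichael iff T ≡ φ(r) (mod r). Multiplying by a unit a permutes the units, so a^m T ≡ T; hence if
-- T ≡ φ(r) and a^m ≢ 1 (mod p) for a prime p ∣ r, then p ∣ φ(r) = ∏ (q - 1). For primes q the power
-- sums ∑_{x<q} x^k vanish modulo q when 0 < k < q - 1, so an exponent of (ℤ/q)^× is a multiple of
-- q - 1; a downward induction over the primes of n thus shows that m is an exponent of (ℤ/r)^×,
-- i.e. λ(r) ∣ m. Conversely, if λ(r) ∣ m then T ≡ φ(r) trivially.
module Submission where

open import Defs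

import Algebra.Properties.CommutativeMonoid.Sum
open import Data.Empty using (⊥-elim)
open import Data.Fin using (Fin; toℕ; fromℕ<)
open import Data.Fin.Permutation using (Permutation; permutation; _⟨$⟩ʳ_)
open import Data.Fin.Properties using (toℕ<n; toℕ-fromℕ<; toℕ-injective)
import Data.Integer as ℤ
import Data.Integer.Properties as ℤ
open import Data.List using (List; []; _∷_; map; filter; upTo; applyUpTo; length)
open import Data.List.Membership.Propositional using (_∈_)
open import Data.List.Membership.Propositional.Properties using (∈-filter⁺; ∈-filter⁻; ∈-upTo⁺)
import Data.List.Properties as List
open import Data.List.Relation.Unary.All as All using (All; []; _∷_)
open import Data.List.Relation.Unary.AllPairs using (_∷_)
open import Data.List.Relation.Unary.Any using (here; there)
open import Data.List.Relation.Unary.Unique.Propositional using (Unique)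
import Data.List.Relation.Unary.Unique.Propositional.Properties as Unique
open import Data.Nat
open import Data.Nat.Combinatorics using (_C_; nCn≡1; nC1≡n; k>n⇒nCk≡0; nCk≡nC[n∸k]; nCk+nC[k+1]≡[n+1]C[k+1])
open import Data.Nat.Coprimality as Coprime using (Coprime; coprime?; coprime-Bézout)
open import Data.Nat.DivMod
open import Data.Nat.Divisibility
open import Data.Nat.GCD using (module Bézout)
open import Data.Nat.Induction using (<-rec)
open import Data.Nat.ListAction using (sum; product)
open import Data.Nat.ListAction.Properties using (∈⇒∣product)
open import Data.Nat.Primality
open import Data.Nat.Primality.Factorisation using (factorise; factorisationHasAllPrimeFactors)
open import Data.Nat.Properties
open import Data.Nat.Tactic.RingSolver using (solve-∀)
open import Data.Product using (Σ; ∃₂; _×_; _,_; proj₁; proj₂)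
open import Data.Sum using (inj₁; inj₂; [_,_]′; reduce)
open import Function using (_∘_; id)
open import Function.Bundles using (_⇔_; mk⇔)
import Function.Properties.Equivalence as ⇔
open import Level using (0ℓ)
open import Relation.Binary.Bundles using (Setoid)
open import Relation.Binary.PropositionalEquality
import Relation.Binary.Reasoning.Setoid as SetoidReasoning
open import Relation.Binary.Structures using (IsEquivalence)
open import Relation.Nullary using (¬_; Dec; yes; no)
open import Relation.Nullary.Decidable using (toSum; _×-dec_)

-- Congruences

infix 4 _≡_⟨mod_⟩

_≡_⟨mod_⟩ : ℕ → ℕ → ℕ → Set
x ≡ y ⟨mod N ⟩ = ∃₂ λ k j → x + k * N ≡ y + j * N

module _ {N : ℕ} where

  mod-reflexive : ∀ {x y} → x ≡ y → x ≡ y ⟨mod N ⟩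
  mod-reflexive refl = 0 , 0 , refl

  mod-refl : ∀ {x} → x ≡ x ⟨mod N ⟩
  mod-refl = mod-reflexive refl

  mod-sym : ∀ {x y} → x ≡ y ⟨mod N ⟩ → y ≡ x ⟨mod N ⟩
  mod-sym (k , j , e) = j , k , sym e

  mod-trans : ∀ {x y z} → x ≡ y ⟨mod N ⟩ → y ≡ z ⟨mod N ⟩ → x ≡ z ⟨mod N ⟩
  mod-trans {x} {y} {z} (k , j , e) (k′ , j′ , e′) = k + k′ , j′ + j , (begin
    x + (k + k′) * N     ≡⟨ shuffle x k k′ N ⟩
    (x + k * N) + k′ * N ≡⟨ cong (_+ k′ * N) e ⟩
    (y + j * N) + k′ * N ≡⟨ shuffle y j k′ N ⟨
    y + (j + k′) * N     ≡⟨ cong (λ i → y + i * N) (+-comm j k′) ⟩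
    y + (k′ + j) * N     ≡⟨ shuffle y k′ j N ⟩
    (y + k′ * N) + j * N ≡⟨ cong (_+ j * N) e′ ⟩
    (z + j′ * N) + j * N ≡⟨ shuffle z j′ j N ⟨
    z + (j′ + j) * N ∎)
    where
    open ≡-Reasoning
    shuffle : ∀ x a b N → x + (a + b) * N ≡ (x + a * N) + b * N
    shuffle = solve-∀

  mod-isEquivalence : IsEquivalence (_≡_⟨mod N ⟩)
  mod-isEquivalence = record { refl = mod-refl ; sym = mod-sym ; trans = mod-trans }

mod-setoid : ℕ → Setoid _ _
mod-setoid N = record { isEquivalence = mod-isEquivalence {N} }

module ModReasoning (N : ℕ) = SetoidReasoning (mod-setoid N)

module _ {N : ℕ} where

  +-cong-mod : ∀ {a b c d} → a ≡ b ⟨mod N ⟩ → c ≡ d ⟨mod N ⟩ → a + c ≡ b + d ⟨mod N ⟩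
  +-cong-mod {a} {b} {c} {d} (k , j , e) (k′ , j′ , e′) = k + k′ , j + j′ , (begin
    a + c + (k + k′) * N       ≡⟨ regroup a c k k′ N ⟩
    (a + k * N) + (c + k′ * N) ≡⟨ cong₂ _+_ e e′ ⟩
    (b + j * N) + (d + j′ * N) ≡⟨ regroup b d j j′ N ⟨
    b + d + (j + j′) * N ∎)
    where
    open ≡-Reasoning
    regroup : ∀ a c k k′ N → a + c + (k + k′) * N ≡ (a + k * N) + (c + k′ * N)
    regroup = solve-∀

  *-cong-mod : ∀ {a b c d} → a ≡ b ⟨mod N ⟩ → c ≡ d ⟨mod N ⟩ → a * c ≡ b * d ⟨mod N ⟩
  *-cong-mod {a} {b} {c} {d} (k , j , e) (k′ , j′ , e′) =
    a * k′ + k * c + k * k′ * N , b * j′ + j * d + j * j′ * N , (begin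
    a * c + (a * k′ + k * c + k * k′ * N) * N ≡⟨ expand a c k k′ N ⟩
    (a + k * N) * (c + k′ * N)                ≡⟨ cong₂ _*_ e e′ ⟩
    (b + j * N) * (d + j′ * N)                ≡⟨ expand b d j j′ N ⟨
    b * d + (b * j′ + j * d + j * j′ * N) * N ∎)
    where
    open ≡-Reasoning
    expand : ∀ a c k k′ N → a * c + (a * k′ + k * c + k * k′ * N) * N ≡ (a + k * N) * (c + k′ * N)
    expand = solve-∀

  +-congˡ-mod : ∀ c {x y} → x ≡ y ⟨mod N ⟩ → c + x ≡ c + y ⟨mod N ⟩
  +-congˡ-mod c = +-cong-mod (mod-refl {x = c})

  +-congʳ-mod : ∀ c {x y} → x ≡ y ⟨mod N ⟩ → x + c ≡ y + c ⟨mod N ⟩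
  +-congʳ-mod c p = +-cong-mod p (mod-refl {x = c})

  *-congˡ-mod : ∀ c {x y} → x ≡ y ⟨mod N ⟩ → c * x ≡ c * y ⟨mod N ⟩
  *-congˡ-mod c = *-cong-mod (mod-refl {x = c})

  *-congʳ-mod : ∀ c {x y} → x ≡ y ⟨mod N ⟩ → x * c ≡ y * c ⟨mod N ⟩
  *-congʳ-mod c p = *-cong-mod p (mod-refl {x = c})

  ^-cong-mod : ∀ {a b} e → a ≡ b ⟨mod N ⟩ → a ^ e ≡ b ^ e ⟨mod N ⟩
  ^-cong-mod zero    p = mod-refl
  ^-cong-mod (suc e) p = *-cong-mod p (^-cong-mod e p)

  +-cancelʳ-mod : ∀ {x y} z → x + z ≡ y + z ⟨mod N ⟩ → x ≡ y ⟨mod N ⟩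
  +-cancelʳ-mod {x} {y} z (k , j , e) = k , j , +-cancelʳ-≡ z _ _ (begin
    x + k * N + z ≡⟨ swap x (k * N) z ⟩
    x + z + k * N ≡⟨ e ⟩
    y + z + j * N ≡⟨ swap y (j * N) z ⟨
    y + j * N + z ∎)
    where
    open ≡-Reasoning
    swap : ∀ x u z → x + u + z ≡ x + z + u
    swap = solve-∀

  +-multiple-mod : ∀ x k → x + k * N ≡ x ⟨mod N ⟩
  +-multiple-mod x k = 0 , k , +-identityʳ _

  ∣⇒≡0-mod : ∀ {x} → N ∣ x → x ≡ 0 ⟨mod N ⟩
  ∣⇒≡0-mod (divides q refl) = +-multiple-mod 0 q

  ≡0-mod⇒∣ : ∀ {x} → x ≡ 0 ⟨mod N ⟩ → N ∣ x
  ≡0-mod⇒∣ {x} (k , j , e) =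
    ∣m+n∣m⇒∣n (subst (N ∣_) (sym (trans (+-comm (k * N) x) e)) (n∣m*n j)) (n∣m*n k)

  ≤∧mod⇒∣∸ : ∀ {a b} → a ≤ b → a ≡ b ⟨mod N ⟩ → N ∣ b ∸ a
  ≤∧mod⇒∣∸ {a} {b} a≤b (k , j , e) = ∣m+n∣m⇒∣n (subst (N ∣_) k*N≡j*N+[b∸a] (n∣m*n k)) (n∣m*n j)
    where
    open ≡-Reasoning
    k*N≡j*N+[b∸a] : k * N ≡ j * N + (b ∸ a)
    k*N≡j*N+[b∸a] = +-cancelˡ-≡ a _ _ (begin
      a + k * N             ≡⟨ e ⟩
      b + j * N             ≡⟨ cong (_+ j * N) (m+[n∸m]≡n a≤b) ⟨
      a + (b ∸ a) + j * N   ≡⟨ +-assoc a (b ∸ a) (j * N) ⟩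
      a + ((b ∸ a) + j * N) ≡⟨ cong (a +_) (+-comm (b ∸ a) (j * N)) ⟩
      a + (j * N + (b ∸ a)) ∎)

  ≤∧∣∸⇒mod : ∀ {a b} → a ≤ b → N ∣ b ∸ a → a ≡ b ⟨mod N ⟩
  ≤∧∣∸⇒mod {a} {b} a≤b (divides q e) = q , 0 , (begin
    a + q * N   ≡⟨ cong (a +_) e ⟨
    a + (b ∸ a) ≡⟨ m+[n∸m]≡n a≤b ⟩
    b           ≡⟨ +-identityʳ b ⟨
    b + 0 * N ∎)
    where open ≡-Reasoning

  module _ .{{_ : NonZero N}} where

    %-mod : ∀ x → x ≡ x % N ⟨mod N ⟩
    %-mod x = 0 , x / N , trans (+-identityʳ x) (m≡m%n+[m/n]*n x N)

    mod⇒%≡ : ∀ {x y} → x ≡ y ⟨mod N ⟩ → x % N ≡ y % N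
    mod⇒%≡ {x} {y} (k , j , e) =
      trans (sym ([m+kn]%n≡m%n x k N)) (trans (cong (_% N) e) ([m+kn]%n≡m%n y j N))

    %≡⇒mod : ∀ {x y} → x % N ≡ y % N → x ≡ y ⟨mod N ⟩
    %≡⇒mod {x} {y} e = mod-trans (%-mod x) (mod-trans (mod-reflexive e) (mod-sym (%-mod y)))

    mod-<⇒≡ : ∀ {x y} → x < N → y < N → x ≡ y ⟨mod N ⟩ → x ≡ y
    mod-<⇒≡ {x} {y} x<N y<N p =
      trans (sym (m<n⇒m%n≡m x<N)) (trans (mod⇒%≡ p) (m<n⇒m%n≡m y<N))

    mod? : ∀ x y → Dec (x ≡ y ⟨mod N ⟩)
    mod? x y with x % N ≟ y % N
    ... | yes e = yes (%≡⇒mod e)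
    ... | no ¬e = no (λ p → ¬e (mod⇒%≡ p))

mod-divisor : ∀ {M N x y} → M ∣ N → x ≡ y ⟨mod N ⟩ → x ≡ y ⟨mod M ⟩
mod-divisor {M} {N} {x} {y} (divides q refl) (k , j , e) =
  k * q , j * q , trans (cong (x +_) (*-assoc k q M)) (trans e (cong (y +_) (sym (*-assoc j q M))))

*-mod-*ˡ : ∀ {r x y} d → x ≡ y ⟨mod r ⟩ → d * x ≡ d * y ⟨mod d * r ⟩
*-mod-*ˡ {r} {x} {y} d (k , j , e) = k , j , (begin
  d * x + k * (d * r) ≡⟨ factor d x k r ⟩
  d * (x + k * r)     ≡⟨ cong (d *_) e ⟩
  d * (y + j * r)     ≡⟨ factor d y j r ⟨
  d * y + j * (d * r) ∎)
  where
  open ≡-Reasoning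
  factor : ∀ d x k r → d * x + k * (d * r) ≡ d * (x + k * r)
  factor = solve-∀

*-cancelˡ-mod : ∀ {r x y} d .{{_ : NonZero d}} → d * x ≡ d * y ⟨mod d * r ⟩ → x ≡ y ⟨mod r ⟩
*-cancelˡ-mod {r} {x} {y} d (k , j , e) = k , j , *-cancelˡ-≡ _ _ d (begin
  d * (x + k * r)     ≡⟨ factor d x k r ⟨
  d * x + k * (d * r) ≡⟨ e ⟩
  d * y + j * (d * r) ≡⟨ factor d y j r ⟩
  d * (y + j * r) ∎)
  where
  open ≡-Reasoning
  factor : ∀ d x k r → d * x + k * (d * r) ≡ d * (x + k * r)
  factor = solve-∀

*-cancelʳ-mod-prime : ∀ {p x y} c → Prime p → ¬ p ∣ c → x * c ≡ y * c ⟨mod p ⟩ → x ≡ y ⟨mod p ⟩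
*-cancelʳ-mod-prime {p} {x} {y} c pp p∤c xc≡yc =
  [ (λ x≤y → cancel x≤y xc≡yc) , (λ y≤x → mod-sym (cancel y≤x (mod-sym xc≡yc))) ]′ (≤-total x y)
  where
  cancel : ∀ {x y} → x ≤ y → x * c ≡ y * c ⟨mod p ⟩ → x ≡ y ⟨mod p ⟩
  cancel {x} {y} x≤y xc≡yc = ≤∧∣∸⇒mod x≤y ([ id , ⊥-elim ∘ p∤c ]′
    (euclidsLemma (y ∸ x) c pp (subst (p ∣_) (sym (*-distribʳ-∸ c y x)) (≤∧mod⇒∣∸ (*-monoˡ-≤ c x≤y) xc≡yc))))

mod-inverse : ∀ {a N} .{{_ : NonZero N}} → Coprime a N → Σ ℕ λ a′ → a * a′ ≡ 1 ⟨mod N ⟩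
mod-inverse {a} {N} cop with coprime-Bézout cop
... | Bézout.+- x y eq = x , 0 , y , trans (+-identityʳ _) (trans (*-comm a x) (sym eq))
mod-inverse {a} {suc B} cop | Bézout.-+ x y eq = x * B , y , a * x , (begin
  a * (x * B) + y * suc B   ≡⟨ cong (a * (x * B) +_) eq ⟨
  a * (x * B) + (1 + x * a) ≡⟨ expand a x B ⟩
  1 + a * x * suc B ∎)
  where
  open ≡-Reasoning
  expand : ∀ a x B → a * (x * B) + (1 + x * a) ≡ 1 + a * x * suc B
  expand = solve-∀

∣+a-+b∣≡a∸b : ∀ {a b} → b ≤ a → ℤ.∣ ℤ.+ a ℤ.- ℤ.+ b ∣ ≡ a ∸ b
∣+a-+b∣≡a∸b {a} {b} b≤a =
  trans (cong ℤ.∣_∣ (ℤ.m-n≡m⊖n a b)) (trans (ℤ.∣m⊖n∣≡∣n⊖m∣ a b) (ℤ.∣⊖∣-≤ b≤a))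

∣+a-+b∣≡b∸a : ∀ {a b} → a ≤ b → ℤ.∣ ℤ.+ a ℤ.- ℤ.+ b ∣ ≡ b ∸ a
∣+a-+b∣≡b∸a {a} {b} a≤b = trans (cong ℤ.∣_∣ (ℤ.m-n≡m⊖n a b)) (ℤ.∣⊖∣-≤ a≤b)

mod⇒[mod] : ∀ {N a b} → a ≡ b ⟨mod N ⟩ → a ≡ b [mod N ]
mod⇒[mod] {N} {a} {b} p with ≤-total a b
... | inj₁ a≤b = subst (N ∣_) (sym (∣+a-+b∣≡b∸a a≤b)) (≤∧mod⇒∣∸ a≤b p)
... | inj₂ b≤a = subst (N ∣_) (sym (∣+a-+b∣≡a∸b b≤a)) (≤∧mod⇒∣∸ b≤a (mod-sym p))

[mod]⇒mod : ∀ {N a b} → a ≡ b [mod N ] → a ≡ b ⟨mod N ⟩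
[mod]⇒mod {N} {a} {b} p with ≤-total a b
... | inj₁ a≤b = ≤∧∣∸⇒mod a≤b (subst (N ∣_) (∣+a-+b∣≡b∸a a≤b) p)
... | inj₂ b≤a = mod-sym (≤∧∣∸⇒mod b≤a (subst (N ∣_) (∣+a-+b∣≡a∸b b≤a) p))

[mod]⇔mod : ∀ {N a b} → a ≡ b [mod N ] ⇔ a ≡ b ⟨mod N ⟩
[mod]⇔mod = mk⇔ [mod]⇒mod mod⇒[mod]

-- Finite sums

∑< : ℕ → (ℕ → ℕ) → ℕ
∑< zero    f = 0
∑< (suc N) f = f 0 + ∑< N (λ i → f (suc i))

syntax ∑< N (λ i → t) = ∑[ i < N ] t

∑-cong : ∀ N {f g} → (∀ i → i < N → f i ≡ g i) → ∑< N f ≡ ∑< N g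
∑-cong zero    f≡g = refl
∑-cong (suc N) f≡g = cong₂ _+_ (f≡g 0 z<s) (∑-cong N (λ i i<N → f≡g (suc i) (s<s i<N)))

∑-cong-mod : ∀ N {M f g} → (∀ i → i < N → f i ≡ g i ⟨mod M ⟩) → ∑< N f ≡ ∑< N g ⟨mod M ⟩
∑-cong-mod zero    f≡g = mod-refl
∑-cong-mod (suc N) f≡g = +-cong-mod (f≡g 0 z<s) (∑-cong-mod N (λ i i<N → f≡g (suc i) (s<s i<N)))

∑-+ : ∀ N f g → ∑[ i < N ] (f i + g i) ≡ ∑< N f + ∑< N g
∑-+ zero    f g = refl
∑-+ (suc N) f g = trans (cong (f 0 + g 0 +_) (∑-+ N _ _)) (+-+-comm (f 0) (g 0) _ _)
  where
  +-+-comm : ∀ a b c d → a + b + (c + d) ≡ a + c + (b + d)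
  +-+-comm = solve-∀

∑-*ˡ : ∀ N c f → ∑[ i < N ] (c * f i) ≡ c * ∑< N f
∑-*ˡ zero    c f = sym (*-zeroʳ c)
∑-*ˡ (suc N) c f = trans (cong (c * f 0 +_) (∑-*ˡ N c _)) (sym (*-distribˡ-+ c (f 0) _))

∑-const : ∀ N c → ∑[ i < N ] c ≡ N * c
∑-const zero    c = refl
∑-const (suc N) c = cong (c +_) (∑-const N c)

∑-zero : ∀ N → ∑[ i < N ] 0 ≡ 0
∑-zero N = trans (∑-const N 0) (*-zeroʳ N)

∑-+-split : ∀ a b f → ∑< (a + b) f ≡ ∑< a f + ∑[ i < b ] f (a + i)
∑-+-split zero    b f = refl
∑-+-split (suc a) b f = trans (cong (f 0 +_) (∑-+-split a b _)) (sym (+-assoc (f 0) _ _))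

∑-last : ∀ N f → ∑< (suc N) f ≡ ∑< N f + f N
∑-last zero    f = +-identityʳ (f 0)
∑-last (suc N) f = trans (cong (f 0 +_) (∑-last N _)) (sym (+-assoc (f 0) _ _))

∑-shift : ∀ N f → ∑[ i < N ] f (suc i) + f 0 ≡ ∑< N f + f N
∑-shift N f = trans (+-comm _ (f 0)) (∑-last N f)

∑-swap : ∀ a b (f : ℕ → ℕ → ℕ) → ∑[ i < a ] ∑[ j < b ] f i j ≡ ∑[ j < b ] ∑[ i < a ] f i j
∑-swap zero    b f = sym (∑-zero b)
∑-swap (suc a) b f = trans (cong (∑[ j < b ] f 0 j +_) (∑-swap a b (λ i j → f (suc i) j)))
                           (sym (∑-+ b (λ j → f 0 j) (λ j → ∑[ i < a ] f (suc i) j)))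

∑-blocks : ∀ d r f → ∑< (d * r) f ≡ ∑[ i < d ] ∑[ c < r ] f (r * i + c)
∑-blocks zero    r f = refl
∑-blocks (suc d) r f = trans (∑-+-split r (d * r) f) (cong₂ _+_
  (∑-cong r (λ c _ → cong (λ i → f (i + c)) (sym (*-zeroʳ r))))
  (trans (∑-blocks d r _) (∑-cong d (λ i _ → ∑-cong r (λ c _ → cong f (shift r i c))))))
  where
  shift : ∀ r i c → r + (r * i + c) ≡ r * suc i + c
  shift = solve-∀

∑-residues : ∀ r d f → ∑< (r * d) f ≡ ∑[ c < r ] ∑[ i < d ] f (c + r * i)
∑-residues r d f = begin
  ∑< (r * d) f                        ≡⟨ cong (λ k → ∑< k f) (*-comm r d) ⟩
  ∑< (d * r) f                        ≡⟨ ∑-blocks d r f ⟩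
  ∑[ i < d ] ∑[ c < r ] f (r * i + c) ≡⟨ ∑-swap d r (λ i c → f (r * i + c)) ⟩
  ∑[ c < r ] ∑[ i < d ] f (r * i + c) ≡⟨ ∑-cong r (λ c _ → ∑-cong d (λ i _ → cong f (+-comm (r * i) c))) ⟩
  ∑[ c < r ] ∑[ i < d ] f (c + r * i) ∎
  where open ≡-Reasoning

module Sum = Algebra.Properties.CommutativeMonoid.Sum +-0-commutativeMonoid

∑<≡sum : ∀ N f → ∑< N f ≡ Sum.sum {N} (λ i → f (toℕ i))
∑<≡sum zero    f = refl
∑<≡sum (suc N) f = cong (f 0 +_) (∑<≡sum N (λ i → f (suc i)))

∑-permute : ∀ N f (σ τ : ℕ → ℕ) → (∀ i → i < N → σ i < N) → (∀ i → i < N → τ i < N) →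
            (∀ i → i < N → τ (σ i) ≡ i) → (∀ i → i < N → σ (τ i) ≡ i) →
            ∑[ i < N ] f (σ i) ≡ ∑< N f
∑-permute N f σ τ σ< τ< τσ στ = begin
  ∑[ i < N ] f (σ i)                     ≡⟨ ∑<≡sum N _ ⟩
  Sum.sum {N} (λ i → f (σ (toℕ i)))      ≡⟨ Sum.sum-cong-≗ {N} (λ i → cong f (sym (toℕ-fromℕ< _))) ⟩
  Sum.sum {N} (λ i → f (toℕ (π ⟨$⟩ʳ i))) ≡⟨ Sum.sum-permute {N} {N} (λ i → f (toℕ i)) π ⟨
  Sum.sum {N} (λ i → f (toℕ i))          ≡⟨ ∑<≡sum N f ⟨
  ∑< N f ∎
  where
  open ≡-Reasoning
  lift : ∀ σ → (∀ i → i < N → σ i < N) → Fin N → Fin N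
  lift σ σ< i = fromℕ< (σ< (toℕ i) (toℕ<n i))
  inverse : ∀ σ τ σ< τ< → (∀ i → i < N → σ (τ i) ≡ i) → ∀ i → lift σ σ< (lift τ τ< i) ≡ i
  inverse σ τ σ< τ< στ i =
    toℕ-injective (trans (toℕ-fromℕ< _) (trans (cong σ (toℕ-fromℕ< _)) (στ (toℕ i) (toℕ<n i))))
  π : Permutation N N
  π = permutation (lift σ σ<) (lift τ τ<) (inverse σ τ σ< τ< στ) (inverse τ σ τ< σ< τσ)

-- Primes and coprimality

prime⇒≢1 : ∀ {p} → Prime p → p ≢ 1
prime⇒≢1 pp refl = ¬prime[1] pp

prime⇒1< : ∀ {p} → Prime p → 1 < p
prime⇒1< {p} pp = nonTrivial⇒n>1 p {{prime⇒nonTrivial pp}}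

prime∣prime⇒≡ : ∀ {p q} → Prime p → Prime q → p ∣ q → p ≡ q
prime∣prime⇒≡ pp pq p∣q = [ ⊥-elim ∘ prime⇒≢1 pp , id ]′ (prime⇒irreducible pq p∣q)

prime∣^⇒∣ : ∀ {p a} k → Prime p → p ∣ a ^ k → p ∣ a
prime∣^⇒∣ zero    pp p∣1 = ⊥-elim (prime⇒≢1 pp (∣1⇒≡1 p∣1))
prime∣^⇒∣ {a = a} (suc k) pp p∣aᵏ⁺¹ = [ id , prime∣^⇒∣ k pp ]′ (euclidsLemma a (a ^ k) pp p∣aᵏ⁺¹)

prime-divisor : ∀ n → 2 ≤ n → Σ ℕ λ p → Prime p × p ∣ n
prime-divisor n 2≤n with factorise n {{>-nonZero (≤-trans (s≤s z≤n) 2≤n)}}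
... | record { factors = [] ; isFactorisation = e } = ⊥-elim (<⇒≢ 2≤n (sym e))
... | record { factors = p ∷ ps ; isFactorisation = e ; factorsPrime = pp ∷ _ } =
  p , pp , subst (p ∣_) (sym e) (m∣m*n (product ps))

coprime∧prime∣⇒∤ : ∀ {k n p} → Coprime k n → Prime p → p ∣ n → ¬ p ∣ k
coprime∧prime∣⇒∤ c pp p∣n p∣k = prime⇒≢1 pp (c (p∣k , p∣n))

noCommonPrime⇒coprime : ∀ {k n} → n ≢ 0 → (∀ {p} → Prime p → p ∣ n → ¬ p ∣ k) → Coprime k n
noCommonPrime⇒coprime n≢0 h {zero}          (_ , 0∣n)   = ⊥-elim (n≢0 (0∣⇒≡0 0∣n))
noCommonPrime⇒coprime n≢0 h {suc zero}      _           = refl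
noCommonPrime⇒coprime n≢0 h {suc (suc i)}   (i∣k , i∣n) with prime-divisor (suc (suc i)) (s≤s (s≤s z≤n))
... | p , pp , p∣i = ⊥-elim (h pp (∣-trans p∣i i∣n) (∣-trans p∣i i∣k))

coprime-∣ : ∀ {x A B} → B ∣ A → Coprime x A → Coprime x B
coprime-∣ B∣A c (d∣x , d∣B) = c (d∣x , ∣-trans d∣B B∣A)

coprime-*ʳ : ∀ {a c A} → Coprime (a * c) A → Coprime c A
coprime-*ʳ {a} c (d∣c , d∣A) = c (∣n⇒∣m*n a d∣c , d∣A)

coprime-* : ∀ {a c A} → A ≢ 0 → Coprime a A → Coprime c A → Coprime (a * c) A
coprime-* {a} {c} A≢0 ca cc = noCommonPrime⇒coprime A≢0 λ pp p∣A →
  [ coprime∧prime∣⇒∤ ca pp p∣A , coprime∧prime∣⇒∤ cc pp p∣A ]′ ∘ euclidsLemma a c pp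

coprime-*-modulus : ∀ {x A B} → A ≢ 0 → B ≢ 0 → Coprime x A → Coprime x B → Coprime x (A * B)
coprime-*-modulus {x} {A} {B} A≢0 B≢0 cA cB =
  noCommonPrime⇒coprime (λ AB≡0 → [ A≢0 , B≢0 ]′ (m*n≡0⇒m≡0∨n≡0 A AB≡0)) λ pp p∣AB →
    [ coprime∧prime∣⇒∤ cA pp , coprime∧prime∣⇒∤ cB pp ]′ (euclidsLemma A B pp p∣AB)

coprime-mod : ∀ {A x y} → A ≢ 0 → x ≡ y ⟨mod A ⟩ → Coprime x A → Coprime y A
coprime-mod A≢0 x≡y cx = noCommonPrime⇒coprime A≢0 λ pp p∣A p∣y →
  coprime∧prime∣⇒∤ cx pp p∣A (≡0-mod⇒∣ (mod-trans (mod-divisor p∣A x≡y) (∣⇒≡0-mod p∣y)))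

coprime-∣⇒*∣ : ∀ {a b X} → Coprime a b → a ∣ X → b ∣ X → a * b ∣ X
coprime-∣⇒*∣ {a} {b} c a∣X (divides t refl) = subst (_∣ t * b) (*-comm b a)
  (subst (b * a ∣_) (*-comm b t) (*-monoʳ-∣ b (Coprime.coprime-divisor c (subst (a ∣_) (*-comm t b) a∣X))))

-- Euler's totient

χ : ℕ → ℕ → ℕ
χ N k with coprime? k N
... | yes _ = 1
... | no  _ = 0

χ-coprime : ∀ {N k} → Coprime k N → χ N k ≡ 1
χ-coprime {N} {k} c with coprime? k N
... | yes _ = refl
... | no ¬c = ⊥-elim (¬c c)

χ-¬coprime : ∀ {N k} → ¬ Coprime k N → χ N k ≡ 0
χ-¬coprime {N} {k} ¬c with coprime? k N
... | yes c = ⊥-elim (¬c c)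
... | no  _ = refl

χ-cong : ∀ {N k N′ k′} → (Coprime k N → Coprime k′ N′) → (Coprime k′ N′ → Coprime k N) → χ N k ≡ χ N′ k′
χ-cong {N} {k} f g with coprime? k N
... | yes c = sym (χ-coprime (f c))
... | no ¬c = sym (χ-¬coprime (¬c ∘ g))

χ-mod : ∀ {A x y} → A ≢ 0 → x ≡ y ⟨mod A ⟩ → χ A x ≡ χ A y
χ-mod A≢0 x≡y = χ-cong (coprime-mod A≢0 x≡y) (coprime-mod A≢0 (mod-sym x≡y))

χ-* : ∀ {A B} → A ≢ 0 → B ≢ 0 → ∀ x → χ (A * B) x ≡ χ A x * χ B x
χ-* {A} {B} A≢0 B≢0 x with coprime? x A | coprime? x B
... | yes cA | yes cB = χ-coprime (coprime-*-modulus A≢0 B≢0 cA cB)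
... | no ¬cA | _      = χ-¬coprime (¬cA ∘ coprime-∣ (m∣m*n B))
... | yes _  | no ¬cB = χ-¬coprime (¬cB ∘ coprime-∣ (n∣m*n A))

χ*-cong-mod : ∀ {M A k x y} → (Coprime k A → x ≡ y ⟨mod M ⟩) → χ A k * x ≡ χ A k * y ⟨mod M ⟩
χ*-cong-mod {A = A} {k} h with coprime? k A
... | yes c = *-congˡ-mod 1 (h c)
... | no  _ = mod-refl

-- Counts the units in [0, N) rather than [1, N] as φ does; the two agree (φ≡Φ).
Φ : ℕ → ℕ
Φ N = ∑< N (χ N)

module _ {A B : ℕ} .{{_ : NonZero B}} (A⊥B : Coprime A B) where

  private
    A′ : ℕ
    A′ = proj₁ (mod-inverse A⊥B)

    AA′≡1 : A * A′ ≡ 1 ⟨mod B ⟩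
    AA′≡1 = proj₂ (mod-inverse A⊥B)

    -- an additive inverse of c modulo B that avoids truncated subtraction
    c̄ : ℕ → ℕ
    c̄ c = B ∸ c % B

    c+c̄≡0 : ∀ c → c + c̄ c ≡ 0 ⟨mod B ⟩
    c+c̄≡0 c = begin
      c + c̄ c     ≈⟨ +-congʳ-mod (c̄ c) (%-mod c) ⟩
      c % B + c̄ c ≡⟨ m+[n∸m]≡n (<⇒≤ (m%n<n c B)) ⟩
      B           ≈⟨ ∣⇒≡0-mod ∣-refl ⟩
      0 ∎
      where open ModReasoning B

  affine-permute : ∀ c f → ∑[ i < B ] f ((c + A * i) % B) ≡ ∑< B f
  affine-permute c f = ∑-permute B f σ τ (λ i _ → m%n<n _ B) (λ i _ → m%n<n _ B) τσ≡id στ≡id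
    where
    σ τ : ℕ → ℕ
    σ i = (c + A * i) % B
    τ y = (A′ * (y + c̄ c)) % B

    A′A≡1 : A′ * A ≡ 1 ⟨mod B ⟩
    A′A≡1 = mod-trans (mod-reflexive (*-comm A′ A)) AA′≡1

    τσ≡id : ∀ i → i < B → τ (σ i) ≡ i
    τσ≡id i i<B = mod-<⇒≡ (m%n<n _ B) i<B (begin
      τ (σ i)                  ≈⟨ %-mod _ ⟨
      A′ * (σ i + c̄ c)         ≈⟨ *-congˡ-mod A′ (+-congʳ-mod (c̄ c) (%-mod (c + A * i))) ⟨
      A′ * ((c + A * i) + c̄ c) ≡⟨ cong (A′ *_) (swap c (A * i) (c̄ c)) ⟩
      A′ * (A * i + (c + c̄ c)) ≈⟨ *-congˡ-mod A′ (+-congˡ-mod (A * i) (c+c̄≡0 c)) ⟩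
      A′ * (A * i + 0)         ≡⟨ cong (A′ *_) (+-identityʳ _) ⟩
      A′ * (A * i)             ≡⟨ *-assoc A′ A i ⟨
      A′ * A * i               ≈⟨ *-congʳ-mod i A′A≡1 ⟩
      1 * i                    ≡⟨ *-identityˡ i ⟩
      i ∎)
      where
      open ModReasoning B
      swap : ∀ c a e → c + a + e ≡ a + (c + e)
      swap = solve-∀

    στ≡id : ∀ y → y < B → σ (τ y) ≡ y
    στ≡id y y<B = mod-<⇒≡ (m%n<n _ B) y<B (begin
      σ (τ y)                  ≈⟨ %-mod _ ⟨
      c + A * τ y              ≈⟨ +-congˡ-mod c (*-congˡ-mod A (%-mod _)) ⟨
      c + A * (A′ * (y + c̄ c)) ≡⟨ cong (c +_) (*-assoc A A′ _) ⟨
      c + A * A′ * (y + c̄ c)   ≈⟨ +-congˡ-mod c (*-congʳ-mod (y + c̄ c) AA′≡1) ⟩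
      c + 1 * (y + c̄ c)        ≡⟨ swap c y (c̄ c) ⟩
      y + (c + c̄ c)            ≈⟨ +-congˡ-mod y (c+c̄≡0 c) ⟩
      y + 0                    ≡⟨ +-identityʳ y ⟩
      y ∎)
      where
      open ModReasoning B
      swap : ∀ c y e → c + 1 * (y + e) ≡ y + (c + e)
      swap = solve-∀

Φ-* : ∀ {A B} .{{_ : NonZero A}} .{{_ : NonZero B}} → Coprime A B → Φ (A * B) ≡ Φ A * Φ B
Φ-* {A} {B} A⊥B = begin
  ∑< (A * B) (χ (A * B))                                ≡⟨ ∑-residues A B _ ⟩
  ∑[ c < A ] ∑[ i < B ] χ (A * B) (c + A * i)           ≡⟨ ∑-cong A (λ c _ → ∑-cong B (λ i _ → χ-residues c i)) ⟩
  ∑[ c < A ] ∑[ i < B ] (χ A c * χ B ((c + A * i) % B)) ≡⟨ ∑-cong A (λ c _ → ∑-*ˡ B (χ A c) _) ⟩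
  ∑[ c < A ] (χ A c * ∑[ i < B ] χ B ((c + A * i) % B)) ≡⟨ ∑-cong A (λ c _ → cong (χ A c *_) (affine-permute A⊥B c (χ B))) ⟩
  ∑[ c < A ] (χ A c * Φ B)                              ≡⟨ ∑-cong A (λ c _ → *-comm (χ A c) (Φ B)) ⟩
  ∑[ c < A ] (Φ B * χ A c)                              ≡⟨ ∑-*ˡ A (Φ B) (χ A) ⟩
  Φ B * Φ A                                             ≡⟨ *-comm (Φ B) (Φ A) ⟩
  Φ A * Φ B ∎
  where
  open ≡-Reasoning
  A≢0 : A ≢ 0
  A≢0 = ≢-nonZero⁻¹ A
  B≢0 : B ≢ 0
  B≢0 = ≢-nonZero⁻¹ B
  χ-residues : ∀ c i → χ (A * B) (c + A * i) ≡ χ A c * χ B ((c + A * i) % B)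
  χ-residues c i = trans (χ-* A≢0 B≢0 (c + A * i)) (cong₂ _*_
    (χ-mod A≢0 (mod-trans (mod-reflexive (cong (c +_) (*-comm A i))) (+-multiple-mod c i)))
    (χ-mod B≢0 (%-mod (c + A * i))))

Φ-prime : ∀ {q} → Prime q → Φ q ≡ q ∸ 1
Φ-prime {suc q′} pq = begin
  χ (suc q′) 0 + ∑[ i < q′ ] χ (suc q′) (suc i)
    ≡⟨ cong₂ _+_ (χ-¬coprime ¬0⊥q) (∑-cong q′ (λ i i<q′ → χ-coprime (sucᵢ⊥q i<q′))) ⟩
  ∑[ i < q′ ] 1                                 ≡⟨ ∑-const q′ 1 ⟩
  q′ * 1                                        ≡⟨ *-identityʳ q′ ⟩
  q′ ∎
  where
  open ≡-Reasoning
  ¬0⊥q : ¬ Coprime 0 (suc q′)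
  ¬0⊥q c = prime⇒≢1 pq (c (suc q′ ∣0 , ∣-refl))
  sucᵢ⊥q : ∀ {i} → i < q′ → Coprime (suc i) (suc q′)
  sucᵢ⊥q i<q′ = Coprime.sym (Coprime.prime⇒coprime pq (s<s i<q′))

distinctPrimes-head-coprime : ∀ {q ys} → All Prime (q ∷ ys) → Unique (q ∷ ys) → Coprime q (product ys)
distinctPrimes-head-coprime {q} {ys} (pq ∷ pys) (q∉ys ∷ _) =
  noCommonPrime⇒coprime (≢-nonZero⁻¹ _ {{productOfPrimes≢0 pys}}) λ pp p∣ys p∣q →
    All.lookup q∉ys (subst (_∈ ys) (prime∣prime⇒≡ pp pq p∣q) (factorisationHasAllPrimeFactors pp p∣ys pys)) refl

Φ-distinctPrimes : ∀ {xs} → All Prime xs → Unique xs → Φ (product xs) ≡ product (map (_∸ 1) xs)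
Φ-distinctPrimes {[]} _ _ = χ-coprime {1} {0} (∣1⇒≡1 ∘ proj₂)
Φ-distinctPrimes {q ∷ ys} ps@(pq ∷ pys) us@(_ ∷ uys) =
  trans (Φ-* {{prime⇒nonZero pq}} {{productOfPrimes≢0 pys}} (distinctPrimes-head-coprime ps us))
        (cong₂ _*_ (Φ-prime pq) (Φ-distinctPrimes pys uys))

prime∣product⇒∣∈ : ∀ {p} f xs → Prime p → p ∣ product (map f xs) → Σ ℕ λ q → q ∈ xs × p ∣ f q
prime∣product⇒∣∈ f []       pp p∣1 = ⊥-elim (prime⇒≢1 pp (∣1⇒≡1 p∣1))
prime∣product⇒∣∈ f (x ∷ xs) pp p∣ with euclidsLemma (f x) (product (map f xs)) pp p∣
... | inj₁ p∣fx = x , here refl , p∣fx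
... | inj₂ p∣rest with prime∣product⇒∣∈ f xs pp p∣rest
...   | q , q∈xs , p∣fq = q , there q∈xs , p∣fq

-- Fermat's little theorem and power sums

[k+1]*[n+1]C[k+1]≡[n+1]*nCk : ∀ n k → suc k * (suc n C suc k) ≡ suc n * (n C k)
[k+1]*[n+1]C[k+1]≡[n+1]*nCk zero zero = refl
[k+1]*[n+1]C[k+1]≡[n+1]*nCk zero (suc k) = begin
  suc (suc k) * (1 C suc (suc k)) ≡⟨ cong (suc (suc k) *_) (k>n⇒nCk≡0 {1} {suc (suc k)} (s<s z<s)) ⟩
  suc (suc k) * 0                 ≡⟨ *-zeroʳ (suc (suc k)) ⟩
  0                               ≡⟨ k>n⇒nCk≡0 {0} {suc k} z<s ⟨
  1 * (0 C suc k) ∎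
  where open ≡-Reasoning
[k+1]*[n+1]C[k+1]≡[n+1]*nCk (suc n) zero =
  trans (*-identityˡ _) (trans (nC1≡n (suc (suc n))) (sym (*-identityʳ _)))
[k+1]*[n+1]C[k+1]≡[n+1]*nCk (suc n) (suc k) = begin
  (2 + k) * ((2 + n) C (2 + k))                                       ≡⟨ cong ((2 + k) *_) (pascal (1 + n) (1 + k)) ⟨
  (2 + k) * ((1 + n) C (1 + k) + (1 + n) C (2 + k))                   ≡⟨ split (1 + k) ((1 + n) C (1 + k)) ((1 + n) C (2 + k)) ⟩
  (1 + k) * ((1 + n) C (1 + k)) + (1 + n) C (1 + k) + (2 + k) * ((1 + n) C (2 + k))
    ≡⟨ cong₂ (λ a b → a + (1 + n) C (1 + k) + b) ([k+1]*[n+1]C[k+1]≡[n+1]*nCk n k) ([k+1]*[n+1]C[k+1]≡[n+1]*nCk n (suc k)) ⟩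
  (1 + n) * (n C k) + (1 + n) C (1 + k) + (1 + n) * (n C (1 + k))
    ≡⟨ cong (λ c → (1 + n) * (n C k) + c + (1 + n) * (n C (1 + k))) (pascal n k) ⟨
  (1 + n) * (n C k) + (n C k + n C (1 + k)) + (1 + n) * (n C (1 + k)) ≡⟨ merge (1 + n) (n C k) (n C (1 + k)) ⟩
  (2 + n) * (n C k + n C (1 + k))                                     ≡⟨ cong ((2 + n) *_) (pascal n k) ⟩
  (2 + n) * ((1 + n) C (1 + k)) ∎
  where
  open ≡-Reasoning
  pascal : ∀ n k → n C k + n C suc k ≡ suc n C suc k
  pascal = nCk+nC[k+1]≡[n+1]C[k+1]
  split : ∀ j a b → suc j * (a + b) ≡ j * a + a + suc j * b
  split = solve-∀
  merge : ∀ m a b → m * a + (a + b) + m * b ≡ suc m * (a + b)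
  merge = solve-∀

[n+1]Cn≡n+1 : ∀ n → suc n C n ≡ suc n
[n+1]Cn≡n+1 n = trans (nCk≡nC[n∸k] (n≤1+n n)) (trans (cong (suc n C_) (m+n∸n≡m 1 n)) (nC1≡n (suc n)))

binomial : ∀ N x → suc x ^ N ≡ ∑[ j < suc N ] ((N C j) * x ^ j)
binomial zero    x = refl
binomial (suc N) x = begin
  suc x * suc x ^ N                                    ≡⟨ cong (suc x *_) (binomial N x) ⟩
  B + x * B                                            ≡⟨ cong₂ _+_ B≡1+shifted (∑-*ˡ (suc N) x (λ j → (N C j) * x ^ j)) ⟨
  1 + (∑[ j < suc N ] ((N C suc j) * x ^ suc j) + ∑[ j < suc N ] (x * ((N C j) * x ^ j)))
    ≡⟨ cong suc (∑-+ (suc N) (λ j → (N C suc j) * x ^ suc j) (λ j → x * ((N C j) * x ^ j))) ⟨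
  1 + ∑[ j < suc N ] ((N C suc j) * x ^ suc j + x * ((N C j) * x ^ j))
    ≡⟨ cong suc (∑-cong (suc N) λ j _ → collect (N C j) (N C suc j) x (x ^ j)) ⟩
  1 + ∑[ j < suc N ] ((N C j + N C suc j) * x ^ suc j)
    ≡⟨ cong suc (∑-cong (suc N) λ j _ → cong (_* x ^ suc j) (nCk+nC[k+1]≡[n+1]C[k+1] N j)) ⟩
  1 + ∑[ j < suc N ] ((suc N C suc j) * x ^ suc j) ∎
  where
  open ≡-Reasoning
  B : ℕ
  B = ∑[ j < suc N ] ((N C j) * x ^ j)
  B≡1+shifted : 1 + ∑[ j < suc N ] ((N C suc j) * x ^ suc j) ≡ B
  B≡1+shifted = cong suc (begin
    ∑[ j < suc N ] ((N C suc j) * x ^ suc j)                       ≡⟨ ∑-last N _ ⟩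
    ∑[ j < N ] ((N C suc j) * x ^ suc j) + (N C suc N) * x ^ suc N
      ≡⟨ cong (λ c → ∑[ j < N ] ((N C suc j) * x ^ suc j) + c * x ^ suc N) (k>n⇒nCk≡0 (n<1+n N)) ⟩
    ∑[ j < N ] ((N C suc j) * x ^ suc j) + 0                       ≡⟨ +-identityʳ _ ⟩
    ∑[ j < N ] ((N C suc j) * x ^ suc j) ∎)
  collect : ∀ a b x y → b * (x * y) + x * (a * y) ≡ (a + b) * (x * y)
  collect = solve-∀

prime∣C : ∀ {q} → Prime q → ∀ {j} → 0 < j → j < q → q ∣ q C j
prime∣C {suc q′} pq {suc j} _ j<q =
  [ (λ q∣j → ⊥-elim (<⇒≱ j<q (∣⇒≤ q∣j))) , id ]′
    (euclidsLemma (suc j) (suc q′ C suc j) pq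
      (subst (suc q′ ∣_) (sym ([k+1]*[n+1]C[k+1]≡[n+1]*nCk q′ j)) (m∣m*n (q′ C j))))

fermat : ∀ {q} → Prime q → ∀ x → x ^ q ≡ x ⟨mod q ⟩
fermat {suc q′} pq zero    = mod-refl
fermat {suc q′} pq (suc x) = begin
  suc x ^ q                                                     ≡⟨ binomial q x ⟩
  1 + ∑[ j < q ] ((q C suc j) * x ^ suc j)                      ≡⟨ cong suc (∑-last q′ _) ⟩
  1 + (∑[ j < q′ ] ((q C suc j) * x ^ suc j) + (q C q) * x ^ q)
    ≈⟨ +-congˡ-mod 1 (+-cong-mod inner≡0 (mod-reflexive (cong (_* x ^ q) (nCn≡1 q)))) ⟩
  1 + (0 + 1 * x ^ q)                                           ≡⟨ cong suc (*-identityˡ (x ^ q)) ⟩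
  1 + x ^ q                                                     ≈⟨ +-congˡ-mod 1 (fermat pq x) ⟩
  suc x ∎
  where
  q : ℕ
  q = suc q′
  open ModReasoning q
  inner≡0 : ∑[ j < q′ ] ((q C suc j) * x ^ suc j) ≡ 0 ⟨mod q ⟩
  inner≡0 = mod-trans (∑-cong-mod q′ λ j j<q′ → *-congʳ-mod (x ^ suc j) (∣⇒≡0-mod (prime∣C pq z<s (s<s j<q′))))
                      (mod-reflexive (∑-zero q′))

fermat-unit : ∀ {q x} → Prime q → ¬ q ∣ x → x ^ (q ∸ 1) ≡ 1 ⟨mod q ⟩
fermat-unit {suc q′} {x} pq q∤x = *-cancelʳ-mod-prime x pq q∤x (begin
  x ^ q′ * x ≡⟨ *-comm (x ^ q′) x ⟩
  x ^ suc q′ ≈⟨ fermat pq x ⟩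
  x          ≡⟨ *-identityˡ x ⟨
  1 * x ∎)
  where open ModReasoning (suc q′)

^≡^%-mod : ∀ {N x e} .{{_ : NonZero e}} → x ^ e ≡ 1 ⟨mod N ⟩ → ∀ k → x ^ k ≡ x ^ (k % e) ⟨mod N ⟩
^≡^%-mod {N} {x} {e} xᵉ≡1 k = begin
  x ^ k                           ≡⟨ cong (x ^_) (trans (m≡m%n+[m/n]*n k e) (cong (k % e +_) (*-comm (k / e) e))) ⟩
  x ^ (k % e + e * (k / e))       ≡⟨ ^-distribˡ-+-* x (k % e) (e * (k / e)) ⟩
  x ^ (k % e) * x ^ (e * (k / e)) ≡⟨ cong (x ^ (k % e) *_) (^-*-assoc x e (k / e)) ⟨
  x ^ (k % e) * (x ^ e) ^ (k / e) ≈⟨ *-congˡ-mod (x ^ (k % e)) (^-cong-mod (k / e) xᵉ≡1) ⟩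
  x ^ (k % e) * 1 ^ (k / e)       ≡⟨ cong (x ^ (k % e) *_) (^-zeroˡ (k / e)) ⟩
  x ^ (k % e) * 1                 ≡⟨ *-identityʳ _ ⟩
  x ^ (k % e) ∎
  where open ModReasoning N

^-cong-exponent-mod : ∀ {N x e a b} .{{_ : NonZero e}} → x ^ e ≡ 1 ⟨mod N ⟩ → a ≡ b ⟨mod e ⟩ → x ^ a ≡ x ^ b ⟨mod N ⟩
^-cong-exponent-mod {x = x} xᵉ≡1 a≡b = mod-trans (^≡^%-mod xᵉ≡1 _)
  (mod-trans (mod-reflexive (cong (x ^_) (mod⇒%≡ a≡b))) (mod-sym (^≡^%-mod xᵉ≡1 _)))

^-distribʳ-* : ∀ a b k → (a * b) ^ k ≡ a ^ k * b ^ k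
^-distribʳ-* a b zero    = refl
^-distribʳ-* a b (suc k) = trans (cong (a * b *_) (^-distribʳ-* a b k)) (interchange a b (a ^ k) (b ^ k))
  where
  interchange : ∀ a b x y → a * b * (x * y) ≡ a * x * (b * y)
  interchange = solve-∀

powerSum : ℕ → ℕ → ℕ
powerSum q k = ∑[ x < q ] (x ^ k)

-- From ∑ₓ (x + 1)^(k+1) − x^(k+1) = q^(k+1), expanding (x + 1)^(k+1) binomially.
powerSum-recurrence : ∀ q k → ∑[ j < suc k ] ((suc k C j) * powerSum q j) ≡ q ^ suc k
powerSum-recurrence q k = +-cancelʳ-≡ (powerSum q (suc k)) _ _ (begin
  ∑< (suc k) g + powerSum q (suc k)                     ≡⟨ cong (∑< (suc k) g +_) (*-identityˡ _) ⟨
  ∑< (suc k) g + 1 * powerSum q (suc k)                 ≡⟨ cong (λ c → ∑< (suc k) g + c * powerSum q (suc k)) (nCn≡1 (suc k)) ⟨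
  ∑< (suc k) g + g (suc k)                              ≡⟨ ∑-last (suc k) g ⟨
  ∑< (suc (suc k)) g                                    ≡⟨ ∑-cong (suc (suc k)) (λ j _ → ∑-*ˡ q (suc k C j) (_^ j)) ⟨
  ∑[ j < suc (suc k) ] ∑[ x < q ] ((suc k C j) * x ^ j) ≡⟨ ∑-swap q (suc (suc k)) (λ x j → (suc k C j) * x ^ j) ⟨
  ∑[ x < q ] ∑[ j < suc (suc k) ] ((suc k C j) * x ^ j) ≡⟨ ∑-cong q (λ x _ → binomial (suc k) x) ⟨
  ∑[ x < q ] (suc x ^ suc k)                            ≡⟨ +-identityʳ _ ⟨
  ∑[ x < q ] (suc x ^ suc k) + 0 ^ suc k                ≡⟨ ∑-shift q (_^ suc k) ⟩
  powerSum q (suc k) + q ^ suc k                        ≡⟨ +-comm _ (q ^ suc k) ⟩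
  q ^ suc k + powerSum q (suc k) ∎)
  where
  open ≡-Reasoning
  g : ℕ → ℕ
  g j = (suc k C j) * powerSum q j

powerSum≡0 : ∀ {q} → Prime q → ∀ k → 1 ≤ k → k + 2 ≤ q → powerSum q k ≡ 0 ⟨mod q ⟩
powerSum≡0 {q} pq = <-rec (λ k → 1 ≤ k → k + 2 ≤ q → powerSum q k ≡ 0 ⟨mod q ⟩) step
  where
  step : ∀ k → (∀ {j} → j < k → 1 ≤ j → j + 2 ≤ q → powerSum q j ≡ 0 ⟨mod q ⟩) →
         1 ≤ k → k + 2 ≤ q → powerSum q k ≡ 0 ⟨mod q ⟩
  step (suc k′) rec _ k+2≤q = *-cancelʳ-mod-prime (suc k) pq q∤k+1 (begin
    powerSum q k * suc k ≡⟨ *-comm (powerSum q k) (suc k) ⟩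
    suc k * powerSum q k ≡⟨ cong (_* powerSum q k) ([n+1]Cn≡n+1 k) ⟨
    g k                  ≈⟨ +-cancelʳ-mod (∑< k g) (mod-sym k-th-term) ⟩
    0 * suc k ∎)
    where
    open ModReasoning q
    k : ℕ
    k = suc k′
    g : ℕ → ℕ
    g j = (suc k C j) * powerSum q j
    q∤k+1 : ¬ q ∣ suc k
    q∤k+1 q∣k+1 = <⇒≱ (≤-trans (n<1+n (suc k)) (subst (_≤ q) (+-comm k 2) k+2≤q)) (∣⇒≤ q∣k+1)
    g₀≡0 : g 0 ≡ 0 ⟨mod q ⟩
    g₀≡0 = mod-trans (mod-reflexive (trans (*-identityˡ _) (trans (∑-const q 1) (*-identityʳ q)))) (∣⇒≡0-mod ∣-refl)
    middle≡0 : ∑[ j < k′ ] g (suc j) ≡ 0 ⟨mod q ⟩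
    middle≡0 = mod-trans
      (∑-cong-mod k′ λ j j<k′ → *-congˡ-mod (suc k C suc j)
        (rec (s<s j<k′) (s≤s z≤n) (≤-trans (+-monoˡ-≤ 2 (<⇒≤ (s<s j<k′))) k+2≤q)))
      (mod-reflexive (trans (∑-cong k′ λ j _ → *-zeroʳ (suc k C suc j)) (∑-zero k′)))
    lower≡0 : ∑< k g ≡ 0 ⟨mod q ⟩
    lower≡0 = +-cong-mod g₀≡0 middle≡0
    k-th-term : 0 * suc k + ∑< k g ≡ g k + ∑< k g ⟨mod q ⟩
    k-th-term = begin
      0 + ∑< k g   ≈⟨ +-congˡ-mod 0 lower≡0 ⟩
      0            ≈⟨ ∣⇒≡0-mod (m∣m*n (q ^ k)) ⟨
      q ^ suc k    ≡⟨ powerSum-recurrence q k ⟨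
      ∑< (suc k) g ≡⟨ ∑-last k g ⟩
      ∑< k g + g k ≡⟨ +-comm _ (g k) ⟩
      g k + ∑< k g ∎

-- If ρ = m mod (q - 1) were nonzero, then x^ρ ≡ 1 for all units x, so powerSum q ρ ≡ q - 1.
exponent⇒[p-1]∣ : ∀ {q m} → Prime q → Exponent q m → q ∸ 1 ∣ m
exponent⇒[p-1]∣ {suc (suc s′)} {m} pq xᵐ≡1 with m % suc s′ in m%s≡ρ
... | zero    = m%n≡0⇒n∣m m (suc s′) m%s≡ρ
... | suc ρ′ = ⊥-elim (1+n≢0 (mod-<⇒≡ ≤-refl z<s (begin
  s                      ≡⟨ trans (∑-const s 1) (*-identityʳ s) ⟨
  ∑[ x < s ] 1           ≈⟨ ∑-cong-mod s (λ x x<s → [x+1]ᵖ≡1 x<s) ⟨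
  ∑[ x < s ] (suc x ^ ρ) ≡⟨⟩
  powerSum q ρ           ≈⟨ powerSum≡0 pq ρ (s≤s z≤n) (subst (_≤ q) (+-comm 2 ρ) (s<s ρ<s)) ⟩
  0 ∎)))
  where
  s q ρ : ℕ
  s = suc s′
  q = suc s
  ρ = suc ρ′
  open ModReasoning q
  ρ<s : ρ < s
  ρ<s = subst (_< s) m%s≡ρ (m%n<n m s)
  [x+1]ᵖ≡1 : ∀ {x} → x < s → suc x ^ ρ ≡ 1 ⟨mod q ⟩
  [x+1]ᵖ≡1 {x} x<s = begin
    suc x ^ ρ       ≡⟨ cong (suc x ^_) m%s≡ρ ⟨
    suc x ^ (m % s) ≈⟨ ^≡^%-mod (fermat-unit pq q∤x+1) m ⟨
    suc x ^ m       ≈⟨ [mod]⇒mod (xᵐ≡1 (suc x) x+1⊥q) ⟩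
    1 ∎
    where
    x+1⊥q : Coprime (suc x) q
    x+1⊥q = Coprime.sym (Coprime.prime⇒coprime pq (s<s x<s))
    q∤x+1 : ¬ q ∣ suc x
    q∤x+1 = coprime∧prime∣⇒∤ x+1⊥q pq ∣-refl

-- The radical

distinctPrimes-∣ : ∀ {xs X} → All Prime xs → Unique xs → (∀ {p} → p ∈ xs → p ∣ X) → product xs ∣ X
distinctPrimes-∣ {[]}     _           _             _   = 1∣ _
distinctPrimes-∣ {q ∷ ys} ps@(_ ∷ pys) us@(_ ∷ uys) ∣X =
  coprime-∣⇒*∣ (distinctPrimes-head-coprime ps us) (∣X (here refl)) (distinctPrimes-∣ pys uys (∣X ∘ there))

distinctPrimes-squarefree : ∀ {xs p} → All Prime xs → Unique xs → Prime p → ¬ p * p ∣ product xs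
distinctPrimes-squarefree {[]}     _ _ pp p²∣1 = prime⇒≢1 pp (∣1⇒≡1 (∣-trans (m∣m*n _) p²∣1))
distinctPrimes-squarefree {q ∷ ys} {p} (pq ∷ pys) (q∉ys ∷ uys) pp p²∣ with p ≟ q
... | yes refl = All.lookup q∉ys (factorisationHasAllPrimeFactors pp (*-cancelˡ-∣ p {{prime⇒nonZero pp}} p²∣) pys) refl
... | no p≢q  = distinctPrimes-squarefree pys uys pp (Coprime.coprime-divisor p²⊥q p²∣)
  where
  p²⊥q : Coprime (p * p) q
  p²⊥q = noCommonPrime⇒coprime (≢-nonZero⁻¹ _ {{prime⇒nonZero pq}}) λ {s} ps s∣q s∣p² →
    let s∣p = reduce (euclidsLemma p p ps s∣p²)
    in p≢q (trans (sym (prime∣prime⇒≡ ps pp s∣p)) (prime∣prime⇒≡ ps pq s∣q))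

primeDivisors : ℕ → List ℕ
primeDivisors n = filter (λ p → prime? p ×-dec (p ∣? n)) (upTo (suc n))

module _ {n : ℕ} where

  ∈-primeDivisors⁻ : ∀ {p} → p ∈ primeDivisors n → Prime p × p ∣ n
  ∈-primeDivisors⁻ p∈ = proj₂ (∈-filter⁻ (λ p → prime? p ×-dec (p ∣? n)) {xs = upTo (suc n)} p∈)

  ∈-primeDivisors⁺ : ∀ {p} → n ≢ 0 → Prime p → p ∣ n → p ∈ primeDivisors n
  ∈-primeDivisors⁺ n≢0 pp p∣n = ∈-filter⁺ (λ p → prime? p ×-dec (p ∣? n))
    (∈-upTo⁺ (s≤s (∣⇒≤ {{≢-nonZero n≢0}} p∣n))) (pp , p∣n)

  primeDivisors-prime : All Prime (primeDivisors n)
  primeDivisors-prime = All.tabulate (proj₁ ∘ ∈-primeDivisors⁻)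

  primeDivisors-unique : Unique (primeDivisors n)
  primeDivisors-unique = Unique.filter⁺ (λ p → prime? p ×-dec (p ∣? n)) (Unique.upTo⁺ (suc n))

  radical≢0 : radical n ≢ 0
  radical≢0 = ≢-nonZero⁻¹ _ {{productOfPrimes≢0 primeDivisors-prime}}

  prime∣radical⇒∣ : ∀ {p} → Prime p → p ∣ radical n → p ∣ n
  prime∣radical⇒∣ pp p∣r = proj₂ (∈-primeDivisors⁻ (factorisationHasAllPrimeFactors pp p∣r primeDivisors-prime))

  prime∣⇒∣radical : ∀ {p} → n ≢ 0 → Prime p → p ∣ n → p ∣ radical n
  prime∣⇒∣radical n≢0 pp p∣n = ∈⇒∣product (∈-primeDivisors⁺ n≢0 pp p∣n)

  radical-∣ : ∀ {X} → (∀ {p} → Prime p → p ∣ n → p ∣ X) → radical n ∣ X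
  radical-∣ ∣X = distinctPrimes-∣ primeDivisors-prime primeDivisors-unique
    (λ p∈ → let pp , p∣n = ∈-primeDivisors⁻ p∈ in ∣X pp p∣n)

  radical∣n : radical n ∣ n
  radical∣n = radical-∣ (λ _ p∣n → p∣n)

  radical-squarefree : ∀ {p} → Prime p → ¬ p * p ∣ radical n
  radical-squarefree = distinctPrimes-squarefree primeDivisors-prime primeDivisors-unique

  radical-cofactor-coprime : ∀ {p} → Prime p → (p∣r : p ∣ radical n) → Coprime (quotient p∣r) p
  radical-cofactor-coprime {p} pp p∣r = noCommonPrime⇒coprime (≢-nonZero⁻¹ p {{prime⇒nonZero pp}}) λ ps s∣p s∣M →
    radical-squarefree pp (subst (p * p ∣_) (sym (m∣n⇒n≡quotient*m p∣r))
      (subst (_∣ quotient p∣r * p) (cong (_* p) (prime∣prime⇒≡ ps pp s∣p)) (*-monoˡ-∣ p s∣M)))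

  Φ-radical : Φ (radical n) ≡ product (map (_∸ 1) (primeDivisors n))
  Φ-radical = Φ-distinctPrimes primeDivisors-prime primeDivisors-unique

^-mono-∣ : ∀ R {a b} → a ≤ b → R ^ a ∣ R ^ b
^-mono-∣ R {a} {b} a≤b = subst (R ^ a ∣_)
  (trans (sym (^-distribˡ-+-* R a (b ∸ a))) (cong (R ^_) (m+[n∸m]≡n a≤b))) (m∣m*n (R ^ (b ∸ a)))

-- Peel off one prime factor p of N = M p: M ∣ R^M by induction, and p ∣ R.
∣^self : ∀ N R → N ≢ 0 → (∀ {p} → Prime p → p ∣ N → p ∣ R) → N ∣ R ^ N
∣^self = <-rec (λ N → ∀ R → N ≢ 0 → (∀ {p} → Prime p → p ∣ N → p ∣ R) → N ∣ R ^ N) step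
  where
  step : ∀ N → (∀ {M} → M < N → ∀ R → M ≢ 0 → (∀ {p} → Prime p → p ∣ M → p ∣ R) → M ∣ R ^ M) →
         ∀ R → N ≢ 0 → (∀ {p} → Prime p → p ∣ N → p ∣ R) → N ∣ R ^ N
  step zero                rec R N≢0 _ = ⊥-elim (N≢0 refl)
  step (suc zero)          rec R N≢0 _ = 1∣ _
  step N@(suc (suc N′))    rec R N≢0 ∣R with prime-divisor N (s≤s (s≤s z≤n))
  ... | p , pp , divides M N≡Mp = subst (_∣ R ^ N) (sym N≡Mp)
    (∣-trans (*-pres-∣ M∣Rᴹ (∣R pp (divides M N≡Mp))) (subst (_∣ R ^ N) (*-comm R (R ^ M)) (^-mono-∣ R M<N)))
    where
    M≢0 : M ≢ 0
    M≢0 refl = N≢0 N≡Mp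
    M<N : M < N
    M<N = subst (M <_) (sym N≡Mp) (m<m*n M p {{≢-nonZero M≢0}} (prime⇒1< pp))
    M∣Rᴹ : M ∣ R ^ M
    M∣Rᴹ = rec M<N R M≢0 (λ pq q∣M → ∣R pq (∣-trans q∣M (divides p (trans N≡Mp (*-comm M p)))))

∣radical^self : ∀ n → n ≢ 0 → n ∣ radical n ^ n
∣radical^self n n≢0 = ∣^self n (radical n) n≢0 (prime∣⇒∣radical n≢0)

1<radical : ∀ {n} → 1 < n → 1 < radical n
1<radical {n} 1<n with prime-divisor n 1<n
... | p , pp , p∣n = <-≤-trans (prime⇒1< pp) (∣⇒≤ {{≢-nonZero (radical≢0 {n})}} (prime∣⇒∣radical n≢0 pp p∣n))
  where
  n≢0 : n ≢ 0
  n≢0 refl = <⇒≱ 1<n z≤n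

pred⊥radical : ∀ {n} → 1 ≤ n → Coprime (n ∸ 1) (radical n)
pred⊥radical {n} 1≤n = noCommonPrime⇒coprime (radical≢0 {n}) λ pp p∣r p∣n-1 →
  prime⇒≢1 pp (∣1⇒≡1 (∣m+n∣m⇒∣n (subst (_ ∣_) (sym (m∸n+n≡m 1≤n)) (prime∣radical⇒∣ pp p∣r)) p∣n-1))

-- Residues congruent to 1 modulo r

[1+x]^k≡1+kx : ∀ x k → (1 + x) ^ k ≡ 1 + k * x ⟨mod x * x ⟩
[1+x]^k≡1+kx x zero    = mod-refl
[1+x]^k≡1+kx x (suc k) = begin
  (1 + x) * (1 + x) ^ k       ≈⟨ *-congˡ-mod (1 + x) ([1+x]^k≡1+kx x k) ⟩
  (1 + x) * (1 + k * x)       ≡⟨ expand x k ⟩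
  1 + suc k * x + k * (x * x) ≈⟨ +-multiple-mod (1 + suc k * x) k ⟩
  1 + suc k * x ∎
  where
  open ModReasoning (x * x)
  expand : ∀ x k → (1 + x) * (1 + k * x) ≡ 1 + suc k * x + k * (x * x)
  expand = solve-∀

[1+At]^q≡1 : ∀ {q A} t → q ∣ A → (1 + A * t) ^ q ≡ 1 ⟨mod A * q ⟩
[1+At]^q≡1 {q} {A} t q∣A = begin
  (1 + A * t) ^ q ≈⟨ mod-divisor Aq∣[At]² ([1+x]^k≡1+kx (A * t) q) ⟩
  1 + q * (A * t) ≡⟨ cong (1 +_) (rearrange q A t) ⟩
  1 + t * (A * q) ≈⟨ +-multiple-mod 1 t ⟩
  1 ∎
  where
  open ModReasoning (A * q)
  rearrange : ∀ q A t → q * (A * t) ≡ t * (A * q)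
  rearrange = solve-∀
  square : ∀ A t → (A * t) * (A * t) ≡ t * t * (A * A)
  square = solve-∀
  Aq∣[At]² : A * q ∣ (A * t) * (A * t)
  Aq∣[At]² = ∣-trans (*-monoʳ-∣ A q∣A) (divides (t * t) (square A t))

≡1-mod⇒≡1+* : ∀ {M x} → 1 ≤ x → x ≡ 1 ⟨mod M ⟩ → Σ ℕ λ t → x ≡ 1 + M * t
≡1-mod⇒≡1+* {M} {x} 1≤x x≡1 with ≤∧mod⇒∣∸ 1≤x (mod-sym x≡1)
... | divides t x∸1≡tM = t , trans (sym (m+[n∸m]≡n 1≤x)) (cong (1 +_) (trans x∸1≡tM (*-comm t M)))

[1+rt]^rᴷ≡1 : ∀ r K t → (1 + r * t) ^ (r ^ K) ≡ 1 ⟨mod r ^ suc K ⟩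
[1+rt]^rᴷ≡1 r zero    t = mod-trans (mod-reflexive (rearrange r t)) (+-multiple-mod 1 t)
  where
  rearrange : ∀ r t → (1 + r * t) * 1 ≡ 1 + t * (r * 1)
  rearrange = solve-∀
[1+rt]^rᴷ≡1 r (suc K) t with ≡1-mod⇒≡1+* (m^n>0 (1 + r * t) (r ^ K)) ([1+rt]^rᴷ≡1 r K t)
... | t′ , x≡1+r^[K+1]t′ = begin
  (1 + r * t) ^ (r * r ^ K)   ≡⟨ cong ((1 + r * t) ^_) (*-comm r (r ^ K)) ⟩
  (1 + r * t) ^ (r ^ K * r)   ≡⟨ ^-*-assoc (1 + r * t) (r ^ K) r ⟨
  ((1 + r * t) ^ (r ^ K)) ^ r ≡⟨ cong (_^ r) x≡1+r^[K+1]t′ ⟩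
  (1 + r ^ suc K * t′) ^ r    ≈⟨ mod-divisor (∣-reflexive (*-comm r (r ^ suc K))) ([1+At]^q≡1 t′ (divides (r ^ K) (*-comm r (r ^ K)))) ⟩
  1 ∎
  where open ModReasoning (r ^ suc (suc K))

2*∑[j<n+1]j≡[n+1]*n : ∀ N → 2 * ∑[ j < suc N ] j ≡ suc N * N
2*∑[j<n+1]j≡[n+1]*n zero    = refl
2*∑[j<n+1]j≡[n+1]*n (suc N) = begin
  2 * ∑[ j < suc (suc N) ] j       ≡⟨ cong (2 *_) (∑-last (suc N) (λ j → j)) ⟩
  2 * (∑[ j < suc N ] j + suc N)   ≡⟨ *-distribˡ-+ 2 (∑[ j < suc N ] j) (suc N) ⟩
  2 * ∑[ j < suc N ] j + 2 * suc N ≡⟨ cong (_+ 2 * suc N) (2*∑[j<n+1]j≡[n+1]*n N) ⟩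
  suc N * N + 2 * suc N            ≡⟨ collect N ⟩
  suc (suc N) * suc N ∎
  where
  open ≡-Reasoning
  collect : ∀ N → suc N * N + 2 * suc N ≡ suc (suc N) * suc N
  collect = solve-∀

odd⇒≡1+2* : ∀ {d} → ¬ 2 ∣ d → Σ ℕ λ h → d ≡ suc (2 * h)
odd⇒≡1+2* {d} 2∤d with d % 2 in d%2≡
... | zero        = ⊥-elim (2∤d (m%n≡0⇒n∣m d 2 d%2≡))
... | suc zero    = d / 2 , trans (m≡m%n+[m/n]*n d 2) (trans (cong (_+ d / 2 * 2) d%2≡) (cong suc (*-comm (d / 2) 2)))
... | suc (suc k) = ⊥-elim (<⇒≱ (m%n<n d 2) (subst (2 ≤_) (sym d%2≡) (s≤s (s≤s z≤n))))

∑[j<1+2h]j≡[1+2h]*h : ∀ h → ∑[ j < suc (2 * h) ] j ≡ suc (2 * h) * h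
∑[j<1+2h]j≡[1+2h]*h h = *-cancelˡ-≡ _ _ 2 (trans (2*∑[j<n+1]j≡[n+1]*n (2 * h)) (double h))
  where
  double : ∀ h → suc (2 * h) * (2 * h) ≡ 2 * (suc (2 * h) * h)
  double = solve-∀

∑[1+rj]≡d : ∀ r {d} → ¬ 2 ∣ d → ∑[ j < d ] (1 + r * j) ≡ d ⟨mod r * d ⟩
∑[1+rj]≡d r 2∤d with odd⇒≡1+2* 2∤d
... | h , refl = begin
  ∑[ j < d ] (1 + r * j)            ≡⟨ ∑-+ d (λ _ → 1) (r *_) ⟩
  ∑[ j < d ] 1 + ∑[ j < d ] (r * j) ≡⟨ cong₂ _+_ (trans (∑-const d 1) (*-identityʳ d)) (∑-*ˡ d r (λ j → j)) ⟩
  d + r * ∑[ j < d ] j              ≡⟨ cong (λ s → d + r * s) (∑[j<1+2h]j≡[1+2h]*h h) ⟩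
  d + r * (d * h)                   ≡⟨ cong (d +_) (trans (sym (*-assoc r d h)) (*-comm (r * d) h)) ⟩
  d + h * (r * d)                   ≈⟨ +-multiple-mod d h ⟩
  d ∎
  where
  d : ℕ
  d = suc (2 * h)
  open ModReasoning (r * d)

-- Reduction from n to its radical

module Reduction {n r d m : ℕ} (n≡rd : n ≡ r * d) (1<r : 1 < r) (2∤d : ¬ 2 ∣ d)
                 (m⊥r : Coprime m r) (n∣rᵐ⁺¹ : n ∣ r ^ suc m) where

  r≢0 : r ≢ 0
  r≢0 r≡0 = <⇒≱ 1<r (subst (_≤ 1) (sym r≡0) z≤n)

  d≢0 : d ≢ 0
  d≢0 refl = 2∤d (2 ∣0)

  n≢0 : n ≢ 0
  n≢0 n≡0 = [ r≢0 , d≢0 ]′ (m*n≡0⇒m≡0∨n≡0 r (trans (sym n≡rd) n≡0))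

  instance
    _ : NonZero r
    _ = ≢-nonZero r≢0
    _ : NonZero d
    _ = ≢-nonZero d≢0
    _ : NonZero n
    _ = ≢-nonZero n≢0

  n≡dr : n ≡ d * r
  n≡dr = trans n≡rd (*-comm r d)

  r∣n : r ∣ n
  r∣n = divides d n≡dr

  ⊥r⇒⊥n : ∀ {x} → Coprime x r → Coprime x n
  ⊥r⇒⊥n x⊥r = noCommonPrime⇒coprime n≢0 λ pp p∣n →
    coprime∧prime∣⇒∤ x⊥r pp (prime∣^⇒∣ (suc m) pp (∣-trans p∣n n∣rᵐ⁺¹))

  χn≡χr : ∀ c i → χ n (c + r * i) ≡ χ r c
  χn≡χr c i = trans (χ-cong (coprime-∣ r∣n) ⊥r⇒⊥n)
    (χ-mod r≢0 (mod-trans (mod-reflexive (cong (c +_) (*-comm r i))) (+-multiple-mod c i)))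

  -- E = r^m is an exponent of the multiplicative group 1 + rℤ modulo n.
  E : ℕ
  E = r ^ m

  instance
    _ : NonZero E
    _ = ≢-nonZero (r≢0 ∘ m^n≡0⇒m≡0 r m)

  [1+rt]^E≡1 : ∀ t → (1 + r * t) ^ E ≡ 1 ⟨mod n ⟩
  [1+rt]^E≡1 t = mod-divisor n∣rᵐ⁺¹ ([1+rt]^rᴷ≡1 r m t)

  m⊥E : Coprime m E
  m⊥E = noCommonPrime⇒coprime (≢-nonZero⁻¹ E) λ pp p∣E → coprime∧prime∣⇒∤ m⊥r pp (prime∣^⇒∣ m pp p∣E)

  π : ℕ → ℕ → ℕ
  π a j = ((1 + r * j) ^ a % n) / r

  [1+rj]^a%n≡1+rπ : ∀ a j → (1 + r * j) ^ a % n ≡ 1 + r * π a j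
  [1+rj]^a%n≡1+rπ a j = trans (m≡m%n+[m/n]*n Y r) (cong₂ _+_ Y%r≡1 (*-comm (Y / r) r))
    where
    Y : ℕ
    Y = (1 + r * j) ^ a % n
    Y≡1 : Y ≡ 1 ⟨mod r ⟩
    Y≡1 = begin
      Y               ≈⟨ mod-divisor r∣n (%-mod _) ⟨
      (1 + r * j) ^ a ≈⟨ ^-cong-mod a (mod-trans (mod-reflexive (cong suc (*-comm r j))) (+-multiple-mod 1 j)) ⟩
      1 ^ a           ≡⟨ ^-zeroˡ a ⟩
      1 ∎
      where open ModReasoning r
    Y%r≡1 : Y % r ≡ 1
    Y%r≡1 = trans (mod⇒%≡ Y≡1) (m<n⇒m%n≡m 1<r)

  π<d : ∀ a j → π a j < d
  π<d a j = m<n*o⇒m/o<n (subst ((1 + r * j) ^ a % n <_) n≡dr (m%n<n _ n))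

  1+rj<n : ∀ {j} → j < d → 1 + r * j < n
  1+rj<n {j} j<d = subst (1 + r * j <_) (sym n≡rd)
    (≤-trans (+-monoˡ-≤ (r * j) 1<r) (subst (_≤ r * d) (*-suc r j) (*-monoʳ-≤ r j<d)))

  π-inverse : ∀ {a b} → a * b ≡ 1 ⟨mod E ⟩ → ∀ j → j < d → π b (π a j) ≡ j
  π-inverse {a} {b} ab≡1 j j<d =
    *-cancelˡ-≡ _ _ r (+-cancelˡ-≡ 1 _ _ (mod-<⇒≡ (1+rj<n (π<d b _)) (1+rj<n j<d) (begin
      1 + r * π b (π a j)       ≡⟨ [1+rj]^a%n≡1+rπ b (π a j) ⟨
      (1 + r * π a j) ^ b % n   ≈⟨ %-mod _ ⟨
      (1 + r * π a j) ^ b       ≡⟨ cong (_^ b) ([1+rj]^a%n≡1+rπ a j) ⟨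
      ((1 + r * j) ^ a % n) ^ b ≈⟨ ^-cong-mod b (%-mod _) ⟨
      ((1 + r * j) ^ a) ^ b     ≡⟨ ^-*-assoc (1 + r * j) a b ⟩
      (1 + r * j) ^ (a * b)     ≈⟨ ^-cong-exponent-mod ([1+rt]^E≡1 j) ab≡1 ⟩
      (1 + r * j) ^ 1           ≡⟨ *-identityʳ _ ⟩
      1 + r * j ∎)))
    where open ModReasoning n

  ∑[1+rj]^m≡d : ∑[ j < d ] ((1 + r * j) ^ m) ≡ d ⟨mod n ⟩
  ∑[1+rj]^m≡d = begin
    ∑[ j < d ] ((1 + r * j) ^ m) ≈⟨ ∑-cong-mod d (λ j _ → mod-trans (%-mod _) (mod-reflexive ([1+rj]^a%n≡1+rπ m j))) ⟩
    ∑[ j < d ] (1 + r * π m j)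
      ≡⟨ ∑-permute d (λ j → 1 + r * j) (π m) (π m′) (λ j _ → π<d m j) (λ j _ → π<d m′ j)
                   (π-inverse {m} {m′} mm′≡1) (π-inverse {m′} {m} m′m≡1) ⟩
    ∑[ j < d ] (1 + r * j)            ≈⟨ subst (λ N → _ ≡ d ⟨mod N ⟩) (sym n≡rd) (∑[1+rj]≡d r 2∤d) ⟩
    d ∎
    where
    open ModReasoning n
    m′ : ℕ
    m′ = proj₁ (mod-inverse m⊥E)
    mm′≡1 : m * m′ ≡ 1 ⟨mod E ⟩
    mm′≡1 = proj₂ (mod-inverse m⊥E)
    m′m≡1 : m′ * m ≡ 1 ⟨mod E ⟩
    m′m≡1 = mod-trans (mod-reflexive (*-comm m′ m)) mm′≡1

  coset-sum : ∀ {c} → Coprime c r → ∑[ i < d ] ((c + r * i) ^ m) ≡ c ^ m * d ⟨mod n ⟩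
  coset-sum {c} c⊥r = begin
    ∑[ i < d ] ((c + r * i) ^ m)             ≡⟨ affine-permute c⊥d 0 (λ i → (c + r * i) ^ m) ⟨
    ∑[ i < d ] ((c + r * ((c * i) % d)) ^ m) ≈⟨ ∑-cong-mod d (λ i _ → ^-cong-mod m (+-congˡ-mod c (r*%≡r* (c * i)))) ⟩
    ∑[ i < d ] ((c + r * (c * i)) ^ m)       ≡⟨ ∑-cong d (λ i _ → trans (cong (_^ m) (factor c r i)) (^-distribʳ-* c (1 + r * i) m)) ⟩
    ∑[ i < d ] (c ^ m * (1 + r * i) ^ m)     ≡⟨ ∑-*ˡ d (c ^ m) _ ⟩
    c ^ m * ∑[ i < d ] ((1 + r * i) ^ m)     ≈⟨ *-congˡ-mod (c ^ m) ∑[1+rj]^m≡d ⟩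
    c ^ m * d ∎
    where
    open ModReasoning n
    c⊥d : Coprime c d
    c⊥d = coprime-∣ (divides r n≡rd) (⊥r⇒⊥n c⊥r)
    r*%≡r* : ∀ x → r * (x % d) ≡ r * x ⟨mod n ⟩
    r*%≡r* x = subst (λ N → r * (x % d) ≡ r * x ⟨mod N ⟩) (sym n≡rd) (*-mod-*ˡ r (mod-sym (%-mod x)))
    factor : ∀ c r i → c + r * (c * i) ≡ c * (1 + r * i)
    factor = solve-∀

  T : ℕ
  T = ∑[ c < r ] (χ r c * c ^ m)

  ∑χk^m≡dT : ∑[ k < n ] (χ n k * k ^ m) ≡ d * T ⟨mod n ⟩
  ∑χk^m≡dT = begin
    ∑[ k < n ] (χ n k * k ^ m)                        ≡⟨ cong (λ N → ∑[ k < N ] (χ n k * k ^ m)) n≡rd ⟩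
    ∑[ k < r * d ] (χ n k * k ^ m)                    ≡⟨ ∑-residues r d _ ⟩
    ∑[ c < r ] ∑[ i < d ] (χ n (c + r * i) * (c + r * i) ^ m)
      ≡⟨ ∑-cong r (λ c _ → ∑-cong d λ i _ → cong (_* (c + r * i) ^ m) (χn≡χr c i)) ⟩
    ∑[ c < r ] ∑[ i < d ] (χ r c * (c + r * i) ^ m)   ≡⟨ ∑-cong r (λ c _ → ∑-*ˡ d (χ r c) _) ⟩
    ∑[ c < r ] (χ r c * ∑[ i < d ] ((c + r * i) ^ m)) ≈⟨ ∑-cong-mod r (λ c _ → χ*-cong-mod {A = r} {k = c} coset-sum) ⟩
    ∑[ c < r ] (χ r c * (c ^ m * d))                  ≡⟨ ∑-cong r (λ c _ → rearrange (χ r c) (c ^ m) d) ⟩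
    ∑[ c < r ] (d * (χ r c * c ^ m))                  ≡⟨ ∑-*ˡ r d _ ⟩
    d * T ∎
    where
    open ModReasoning n
    rearrange : ∀ u x d → u * (x * d) ≡ d * (u * x)
    rearrange = solve-∀

  Φn≡dΦr : Φ n ≡ d * Φ r
  Φn≡dΦr = begin
    ∑< n (χ n)             ≡⟨ cong (λ N → ∑< N (χ n)) n≡rd ⟩
    ∑< (r * d) (χ n)       ≡⟨ ∑-residues r d (χ n) ⟩
    ∑[ c < r ] ∑[ i < d ] χ n (c + r * i)
      ≡⟨ ∑-cong r (λ c _ → trans (∑-cong d λ i _ → χn≡χr c i) (∑-const d (χ r c))) ⟩
    ∑[ c < r ] (d * χ r c) ≡⟨ ∑-*ˡ r d (χ r) ⟩
    d * Φ r ∎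
    where open ≡-Reasoning

  ∑χk^m≡Φ⇔T≡Φ : ∑[ k < n ] (χ n k * k ^ m) ≡ Φ n ⟨mod n ⟩ ⇔ T ≡ Φ r ⟨mod r ⟩
  ∑χk^m≡Φ⇔T≡Φ = mk⇔
    (λ S≡Φ → *-cancelˡ-mod d (subst (λ N → d * T ≡ d * Φ r ⟨mod N ⟩) n≡dr
      (mod-trans (mod-sym ∑χk^m≡dT) (mod-trans S≡Φ (mod-reflexive Φn≡dΦr)))))
    (λ T≡Φ → mod-trans ∑χk^m≡dT (mod-trans (subst (λ N → d * T ≡ d * Φ r ⟨mod N ⟩) (sym n≡dr) (*-mod-*ˡ d T≡Φ))
      (mod-reflexive (sym Φn≡dΦr))))

-- Exponents of the units modulo the radical

-- Chinese remaindering: a = 1 + M M′ (x + p - 1), where M M′ ≡ 1 (mod p), is ≡ 1 (mod M) and ≡ x (mod p).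
residue-lift : ∀ {M p x} → Prime p → Coprime M p → ¬ p ∣ x → Σ ℕ λ a → Coprime a (M * p) × a ≡ x ⟨mod p ⟩
residue-lift {M} {p} {x} pp M⊥p p∤x = a , a⊥Mp , a≡x
  where
  instance _ = prime⇒nonZero pp
  M′ X a : ℕ
  M′ = proj₁ (mod-inverse M⊥p)
  X = x + (p ∸ 1)
  a = 1 + M * M′ * X

  MM′≡1 : M * M′ ≡ 1 ⟨mod p ⟩
  MM′≡1 = proj₂ (mod-inverse M⊥p)

  a≡x : a ≡ x ⟨mod p ⟩
  a≡x = begin
    1 + M * M′ * X    ≈⟨ +-congˡ-mod 1 (*-congʳ-mod X MM′≡1) ⟩
    1 + 1 * X         ≡⟨ cong suc (*-identityˡ X) ⟩
    1 + (x + (p ∸ 1)) ≡⟨ cong suc (+-comm x (p ∸ 1)) ⟩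
    1 + (p ∸ 1) + x   ≡⟨ cong (_+ x) (m+[n∸m]≡n (<⇒≤ (prime⇒1< pp))) ⟩
    p + x             ≡⟨ trans (+-comm p x) (cong (x +_) (sym (*-identityˡ p))) ⟩
    x + 1 * p         ≈⟨ +-multiple-mod x 1 ⟩
    x ∎
    where open ModReasoning p

  M≢0 : M ≢ 0
  M≢0 refl = prime⇒≢1 pp (M⊥p (p ∣0 , ∣-refl))

  ∣M⇒∤a : ∀ {q} → Prime q → q ∣ M → ¬ q ∣ a
  ∣M⇒∤a {q} pq q∣M q∣a = prime⇒≢1 pq (∣1⇒≡1 (∣m+n∣m⇒∣n (subst (q ∣_) (+-comm 1 (M * M′ * X)) q∣a)
                                                    (∣-trans q∣M (∣-trans (m∣m*n M′) (m∣m*n X)))))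

  ∣p⇒∤a : ∀ {q} → Prime q → q ∣ p → ¬ q ∣ a
  ∣p⇒∤a pq q∣p q∣a = p∤x (subst (_∣ x) (prime∣prime⇒≡ pq pp q∣p)
                                (≡0-mod⇒∣ (mod-trans (mod-divisor q∣p (mod-sym a≡x)) (∣⇒≡0-mod q∣a))))

  a⊥Mp : Coprime a (M * p)
  a⊥Mp = noCommonPrime⇒coprime (≢-nonZero⁻¹ _ {{m*n≢0 M p {{≢-nonZero M≢0}}}}) λ pq q∣Mp →
    [ ∣M⇒∤a pq , ∣p⇒∤a pq ]′ (euclidsLemma M p pq q∣Mp)

module ExponentCriterion {n m : ℕ} (1<n : 1 < n) (m⊥r : Coprime m (radical n)) where

  r : ℕ
  r = radical n

  n≢0 : n ≢ 0
  n≢0 refl = <⇒≱ 1<n z≤n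

  r≢0 : r ≢ 0
  r≢0 = radical≢0 {n}

  instance
    _ : NonZero r
    _ = ≢-nonZero r≢0

  T : ℕ
  T = ∑[ c < r ] (χ r c * c ^ m)

  exponent⇒T≡Φ : Exponent r m → T ≡ Φ r ⟨mod r ⟩
  exponent⇒T≡Φ aᵐ≡1 = begin
    ∑[ c < r ] (χ r c * c ^ m) ≈⟨ ∑-cong-mod r (λ c _ → χ*-cong-mod {A = r} {k = c} ([mod]⇒mod ∘ aᵐ≡1 c)) ⟩
    ∑[ c < r ] (χ r c * 1)     ≡⟨ ∑-cong r (λ c _ → *-identityʳ (χ r c)) ⟩
    Φ r ∎
    where open ModReasoning r

  aᵐT≡T : ∀ {a} → Coprime a r → a ^ m * T ≡ T ⟨mod r ⟩
  aᵐT≡T {a} a⊥r = begin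
    a ^ m * T                              ≡⟨ ∑-*ˡ r (a ^ m) term ⟨
    ∑[ c < r ] (a ^ m * (χ r c * c ^ m))   ≡⟨ ∑-cong r (λ c _ → multiply c) ⟩
    ∑[ c < r ] (χ r (a * c) * (a * c) ^ m)
      ≈⟨ ∑-cong-mod r (λ c _ → *-cong-mod (mod-reflexive (χ-mod r≢0 (%-mod (a * c)))) (^-cong-mod m (%-mod (a * c)))) ⟩
    ∑[ c < r ] term ((0 + a * c) % r)      ≡⟨ affine-permute a⊥r 0 term ⟩
    T ∎
    where
    open ModReasoning r
    term : ℕ → ℕ
    term c = χ r c * c ^ m
    swap : ∀ x u y → x * (u * y) ≡ u * (x * y)
    swap = solve-∀
    multiply : ∀ c → a ^ m * (χ r c * c ^ m) ≡ χ r (a * c) * (a * c) ^ m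
    multiply c = trans (swap (a ^ m) (χ r c) (c ^ m))
      (cong₂ _*_ (χ-cong (coprime-* r≢0 a⊥r) (coprime-*ʳ {a})) (sym (^-distribʳ-* a c m)))

  module _ (T≡Φ : T ≡ Φ r ⟨mod r ⟩) where

    prime∣Φ : ∀ {p a} → Prime p → p ∣ r → Coprime a r → ¬ a ^ m ≡ 1 ⟨mod p ⟩ → p ∣ Φ r
    prime∣Φ {p} {a} pp p∣r a⊥r aᵐ≢1 with p ∣? Φ r
    ... | yes p∣Φ = p∣Φ
    ... | no  p∤Φ = ⊥-elim (aᵐ≢1 (*-cancelʳ-mod-prime (Φ r) pp p∤Φ (mod-divisor p∣r (begin
      a ^ m * Φ r ≈⟨ *-congˡ-mod (a ^ m) T≡Φ ⟨
      a ^ m * T   ≈⟨ aᵐT≡T a⊥r ⟩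
      T           ≈⟨ T≡Φ ⟩
      Φ r         ≡⟨ *-identityˡ (Φ r) ⟨
      1 * Φ r ∎))))
      where open ModReasoning r

    ∣pred-of-primeDivisor : ∀ {p a} → Prime p → p ∣ r → Coprime a p → ¬ a ^ m ≡ 1 ⟨mod p ⟩ →
                            Σ ℕ λ q → q ∈ primeDivisors n × p ∣ q ∸ 1
    ∣pred-of-primeDivisor {p} {a} pp p∣r a⊥p aᵐ≢1 =
      prime∣product⇒∣∈ (_∸ 1) (primeDivisors n) pp (subst (p ∣_) (Φ-radical {n}) p∣Φr)
      where
      M : ℕ
      M = quotient p∣r
      lift : Σ ℕ λ b → Coprime b (M * p) × b ≡ a ⟨mod p ⟩
      lift = residue-lift pp (radical-cofactor-coprime {n} pp p∣r) (coprime∧prime∣⇒∤ a⊥p pp ∣-refl)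
      b : ℕ
      b = proj₁ lift
      b⊥r : Coprime b r
      b⊥r = subst (Coprime b) (sym (m∣n⇒n≡quotient*m p∣r)) (proj₁ (proj₂ lift))
      p∣Φr : p ∣ Φ r
      p∣Φr = prime∣Φ pp p∣r b⊥r (λ bᵐ≡1 → aᵐ≢1 (mod-trans (^-cong-mod m (mod-sym (proj₂ (proj₂ lift)))) bᵐ≡1))

    -- Downward induction on p: a unit a with a^m ≢ 1 (mod p) gives a larger prime q ∣ n with p ∣ q - 1,
    -- and by induction q - 1 ∣ m; but m = n - 1 is prime to p.
    prime-exponent : ∀ {p} → Prime p → p ∣ n → Exponent p m
    prime-exponent {p} = <-rec P step (n ∸ p) refl
      where
      P : ℕ → Set
      P k = ∀ {p} → n ∸ p ≡ k → Prime p → p ∣ n → Exponent p m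
      step : ∀ k → (∀ {j} → j < k → P j) → P k
      step k rec {p} refl pp p∣n a a⊥p with mod? {{prime⇒nonZero pp}} (a ^ m) 1
      ... | yes aᵐ≡1 = mod⇒[mod] aᵐ≡1
      ... | no  aᵐ≢1 = ⊥-elim (no-larger-prime (∣pred-of-primeDivisor pp p∣r a⊥p aᵐ≢1))
        where
        p∣r : p ∣ r
        p∣r = prime∣⇒∣radical n≢0 pp p∣n
        no-larger-prime : ¬ Σ ℕ (λ q → q ∈ primeDivisors n × p ∣ q ∸ 1)
        no-larger-prime (q , q∈ , p∣q-1) = coprime∧prime∣⇒∤ m⊥r pp p∣r (∣-trans p∣q-1 q-1∣m)
          where
          pq : Prime q
          pq = proj₁ (∈-primeDivisors⁻ {n} q∈)
          q∣n : q ∣ n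
          q∣n = proj₂ (∈-primeDivisors⁻ {n} q∈)
          p<q : p < q
          p<q = <-≤-trans (s≤s (∣⇒≤ {{≢-nonZero (m>n⇒m∸n≢0 (prime⇒1< pq))}} p∣q-1))
                          (≤-reflexive (m+[n∸m]≡n (<⇒≤ (prime⇒1< pq))))
          q-1∣m : q ∸ 1 ∣ m
          q-1∣m = exponent⇒[p-1]∣ pq (rec (∸-monoʳ-< p<q (∣⇒≤ {{≢-nonZero n≢0}} q∣n)) refl pq q∣n)

    T≡Φ⇒exponent : Exponent r m
    T≡Φ⇒exponent a a⊥r = mod⇒[mod] (mod-sym (≤∧∣∸⇒mod 1≤aᵐ (radical-∣ λ pp p∣n →
      ≤∧mod⇒∣∸ 1≤aᵐ (mod-sym ([mod]⇒mod (prime-exponent pp p∣n a (coprime-∣ (prime∣⇒∣radical n≢0 pp p∣n) a⊥r)))))))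
      where
      a≢0 : a ≢ 0
      a≢0 refl = <⇒≢ (1<radical 1<n) (sym (a⊥r (r ∣0 , ∣-refl)))
      1≤aᵐ : 1 ≤ a ^ m
      1≤aᵐ = m^n>0 a {{≢-nonZero a≢0}} m

  T≡Φ⇔exponent : T ≡ Φ r ⟨mod r ⟩ ⇔ Exponent r m
  T≡Φ⇔exponent = mk⇔ T≡Φ⇒exponent exponent⇒T≡Φ

-- The weak Carmichael condition

sum-filter-coprime : ∀ N (g : ℕ → ℕ) xs →
                     sum (map g (filter (λ k → coprime? k N) xs)) ≡ sum (map (λ k → χ N k * g k) xs)
sum-filter-coprime N g []       = refl
sum-filter-coprime N g (x ∷ xs) = [ accept , reject ]′ (toSum (coprime? x N))
  where
  goal : Set
  goal = sum (map g (filter (λ k → coprime? k N) (x ∷ xs))) ≡ sum (map (λ k → χ N k * g k) (x ∷ xs))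
  accept : Coprime x N → goal
  accept x⊥N = trans (cong (sum ∘ map g) (List.filter-accept (λ k → coprime? k N) x⊥N))
    (cong₂ _+_ (sym (trans (cong (_* g x) (χ-coprime x⊥N)) (+-identityʳ (g x)))) (sum-filter-coprime N g xs))
  reject : ¬ Coprime x N → goal
  reject ¬x⊥N = trans (cong (sum ∘ map g) (List.filter-reject (λ k → coprime? k N) ¬x⊥N))
    (cong₂ _+_ (sym (cong (_* g x) (χ-¬coprime ¬x⊥N))) (sum-filter-coprime N g xs))

length-filter-coprime : ∀ N xs → length (filter (λ k → coprime? k N) xs) ≡ sum (map (χ N) xs)
length-filter-coprime N []       = refl
length-filter-coprime N (x ∷ xs) = [ accept , reject ]′ (toSum (coprime? x N))
  where
  goal : Set
  goal = length (filter (λ k → coprime? k N) (x ∷ xs)) ≡ sum (map (χ N) (x ∷ xs))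
  accept : Coprime x N → goal
  accept x⊥N = trans (cong length (List.filter-accept (λ k → coprime? k N) x⊥N))
    (cong₂ _+_ (sym (χ-coprime x⊥N)) (length-filter-coprime N xs))
  reject : ¬ Coprime x N → goal
  reject ¬x⊥N = trans (cong length (List.filter-reject (λ k → coprime? k N) ¬x⊥N))
    (cong₂ _+_ (sym (χ-¬coprime ¬x⊥N)) (length-filter-coprime N xs))

sum-map-applyUpTo : ∀ (h f : ℕ → ℕ) N → sum (map h (applyUpTo f N)) ≡ ∑[ i < N ] h (f i)
sum-map-applyUpTo h f zero    = refl
sum-map-applyUpTo h f (suc N) = cong (h (f 0) +_) (sum-map-applyUpTo h (f ∘ suc) N)

sum-map-suc-upTo : ∀ (h : ℕ → ℕ) N → sum (map h (map suc (upTo N))) ≡ ∑[ i < N ] h (suc i)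
sum-map-suc-upTo h N = trans (cong sum (sym (List.map-∘ (upTo N)))) (sum-map-applyUpTo (h ∘ suc) (λ i → i) N)

module _ {n : ℕ} (1<n : 1 < n) where

  private
    χn0≡0 : χ n 0 ≡ 0
    χn0≡0 = χ-¬coprime λ 0⊥n → <⇒≢ 1<n (sym (0⊥n (n ∣0 , ∣-refl)))

    χnn≡0 : χ n n ≡ 0
    χnn≡0 = χ-¬coprime λ n⊥n → <⇒≢ 1<n (sym (n⊥n (∣-refl , ∣-refl)))

  -- The k = 0 term, absent from weakSum, vanishes in ∑[ k < n ] since 0 is not a unit.
  weakSum≡∑χk^m : weakSum n ≡ ∑[ k < n ] (χ n k * k ^ (n ∸ 1))
  weakSum≡∑χk^m = begin
    weakSum n                                          ≡⟨ sum-filter-coprime n (_^ m) (map suc (upTo m)) ⟩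
    sum (map (λ k → χ n k * k ^ m) (map suc (upTo m))) ≡⟨ sum-map-suc-upTo (λ k → χ n k * k ^ m) m ⟩
    ∑[ i < m ] (χ n (suc i) * suc i ^ m)               ≡⟨ cong (λ z → z * 0 ^ m + ∑[ i < m ] (χ n (suc i) * suc i ^ m)) χn0≡0 ⟨
    ∑[ k < suc m ] (χ n k * k ^ m)                     ≡⟨ cong (λ N → ∑[ k < N ] (χ n k * k ^ m)) (m+[n∸m]≡n (<⇒≤ 1<n)) ⟩
    ∑[ k < n ] (χ n k * k ^ m) ∎
    where
    open ≡-Reasoning
    m : ℕ
    m = n ∸ 1

  φ≡Φ : φ n ≡ Φ n
  φ≡Φ = +-cancelʳ-≡ (χ n 0) _ _ (begin
    φ n + χ n 0                                ≡⟨ cong (_+ χ n 0) (length-filter-coprime n (map suc (upTo n))) ⟩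
    sum (map (χ n) (map suc (upTo n))) + χ n 0 ≡⟨ cong (_+ χ n 0) (sum-map-suc-upTo (χ n) n) ⟩
    ∑[ i < n ] χ n (suc i) + χ n 0             ≡⟨ ∑-shift n (χ n) ⟩
    Φ n + χ n n                                ≡⟨ cong (Φ n +_) (trans χnn≡0 (sym χn0≡0)) ⟩
    Φ n + χ n 0 ∎)
    where open ≡-Reasoning

exponent⇔λ∣ : ∀ {N t e} → IsCarmichaelλ N t → Exponent N e ⇔ t ∣ e
exponent⇔λ∣ {N} {t} {e} (0<t , aᵗ≡1 , t-minimal) = mk⇔ exponent⇒λ∣ λ∣⇒exponent
  where
  instance _ = >-nonZero 0<t
  aᵉ≡aᵉ%ᵗ : ∀ a → Coprime a N → a ^ e ≡ a ^ (e % t) ⟨mod N ⟩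
  aᵉ≡aᵉ%ᵗ a a⊥N = ^≡^%-mod ([mod]⇒mod (aᵗ≡1 a a⊥N)) e
  λ∣⇒exponent : t ∣ e → Exponent N e
  λ∣⇒exponent t∣e a a⊥N = mod⇒[mod] {N} {a ^ e} {1}
    (mod-trans (aᵉ≡aᵉ%ᵗ a a⊥N) (mod-reflexive (cong (a ^_) (n∣m⇒m%n≡0 e t t∣e))))
  exponent⇒λ∣ : Exponent N e → t ∣ e
  exponent⇒λ∣ aᵉ≡1 with e % t in e%t≡ρ
  ... | zero   = m%n≡0⇒n∣m e t e%t≡ρ
  ... | suc ρ′ = ⊥-elim (<⇒≱ (subst (_< t) e%t≡ρ (m%n<n e t)) (t-minimal (suc ρ′) z<s aᵖ≡1))
    where
    aᵖ≡1 : Exponent N (suc ρ′)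
    aᵖ≡1 a a⊥N = mod⇒[mod] {N} {a ^ suc ρ′} {1} (mod-trans (mod-reflexive (cong (a ^_) (sym e%t≡ρ)))
                             (mod-trans (mod-sym (aᵉ≡aᵉ%ᵗ a a⊥N)) ([mod]⇒mod {N} {a ^ e} {1} (aᵉ≡1 a a⊥N))))

weakCarmichael⇔exponent : ∀ {n} → ¬ 2 ∣ n → Composite n → WeakCarmichael n ⇔ Exponent (radical n) (n ∸ 1)
weakCarmichael⇔exponent {n} 2∤n n-composite = begin
  WeakCarmichael n                          ≈⟨ mk⇔ proj₂ (n-composite ,_) ⟩
  weakSum n ≡ φ n [mod n ]                  ≈⟨ [mod]⇔mod ⟩
  weakSum n ≡ φ n ⟨mod n ⟩                  ≡⟨ cong₂ _≡_⟨mod n ⟩ (weakSum≡∑χk^m 1<n) (φ≡Φ 1<n) ⟩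
  ∑[ k < n ] (χ n k * k ^ m) ≡ Φ n ⟨mod n ⟩ ≈⟨ Reduction.∑χk^m≡Φ⇔T≡Φ n≡rd (1<radical 1<n) 2∤d m⊥r n∣rᵐ⁺¹ ⟩
  ∑[ c < r ] (χ r c * c ^ m) ≡ Φ r ⟨mod r ⟩ ≈⟨ ExponentCriterion.T≡Φ⇔exponent 1<n m⊥r ⟩
  Exponent r m ∎
  where
  open SetoidReasoning (⇔.⇔-setoid 0ℓ)
  1<n : 1 < n
  1<n = nonTrivial⇒n>1 n {{composite⇒nonTrivial n-composite}}
  m r d : ℕ
  m = n ∸ 1
  r = radical n
  d = quotient (radical∣n {n})
  n≡rd : n ≡ r * d
  n≡rd = m∣n⇒n≡m*quotient radical∣n
  2∤d : ¬ 2 ∣ d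
  2∤d 2∣d = 2∤n (∣-trans 2∣d (quotient-∣ radical∣n))
  m⊥r : Coprime m r
  m⊥r = pred⊥radical (<⇒≤ 1<n)
  n∣rᵐ⁺¹ : n ∣ r ^ suc m
  n∣rᵐ⁺¹ = subst (λ k → n ∣ r ^ k) (sym (m+[n∸m]≡n (<⇒≤ 1<n)))
    (∣radical^self n (≢-nonZero⁻¹ n {{>-nonZero (<⇒≤ 1<n)}}))

proposition2p50 : (n : ℕ) → ¬ (2 ∣ n) → Composite n →
    (t : ℕ) → IsCarmichaelλ (radical n) t →
    (WeakCarmichael n ⇔ t ∣ n ∸ 1)
proposition2p50 n 2∤n n-composite t λ[n′]≡t =
  ⇔.trans (weakCarmichael⇔exponent 2∤n n-composite) (exponent⇔λ∣ λ[n′]≡t)
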